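{- Assume Rota's conjecture is true, i.e. for every prime power $q$ the class of $\mathrm{GF}(q)$-representable matroids has only finitely many excluded minors. Then for every finite field $\mathrm{GF}(q)$ there is a finite set $\mathcal{Q}$ of sentences in $M$-logic such that a structure $(E,r)$ is a $\mathrm{GF}(q)$-representable matroid if and only if $(E,r)$ satisfies $\{\mathbf{R1},\mathbf{R2},\mathbf{R3}\}\cup\mathcal{Q}$.
   Context: A structure is a pair $(E,r)$ where $E$ is a finite set and $r\colon\mathcal{P}(E)\to\mathbb{Z}_{\ge0}$. A matroid is a structure whose $r$ is a matroid rank function. Monadic second-order logic for matroids (MSOL): element variables $x_1,x_2,\dots$ and set variables $X_1,X_2,\dots$. Set terms are built from $E$, $\emptyset$, set variables, singletons $\{x_i\}$, and closed under complement, $\cup$, $\cap$. Integer terms are built from constants $0,1,2,\dots$, $|X|$ and $r(X)$ for set terms $X$, closed under $+$. Atomic formulas: $x=y$, $X=Y$, $X\subseteq Y$, $p=q$, $p\le q$, $x\in X$. Formulas are built using $\neg,\lor,\land$ and $\exists,\forall$ over element and set variables; sentences have no free variables. In a structure $(E,r)$, element variables range over $E$, set variables over subsets of $E$, $|X|$ is cardinality and $r(X)$ is the given function, all other symbols having their usual meaning. $M$-logic is the set of MSOL formulas equivalent to one of the form $Q_{1}X_{i_1}\cdots Q_{m}X_{i_m}\,Q'_{1}x_{j_1}\cdots Q'_{n}x_{j_n}\,P$ with $P$ quantifier-free, $X_{i_k}$ set variables, $x_{j_k}$ element variables, where all $Q_k$ are the same quantifier and all $Q'_k$ are the same quantifier.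 $\mathbf{R1}$: $\forall X_1\ r(X_1)\le|X_1|$; $\mathbf{R2}$: $\forall X_1\forall X_2\ X_1\subseteq X_2\to r(X_1)\le r(X_2)$; $\mathbf{R3}$: $\forall X_1\forall X_2\ r(X_1\cup X_2)+r(X_1\cap X_2)\le r(X_1)+r(X_2)$. -}

module Defs where

open import Level using (0ℓ)
open import Data.Nat using (ℕ; zero; suc; _+_; _≤_; _<_)
open import Data.Bool using (Bool; true; false; _∧_; _∨_)
open import Data.Fin using (Fin; zero; suc)
open import Data.Fin.Properties using (_≟_)
open import Data.Fin.Subset using (Subset; ⁅_⁆; _∈_; _∉_; _⊆_; ∁; _∪_; _∩_; ∣_∣)
  renaming (⊥ to ∅ˢ; ⊤ to Eˢ)
open import Data.Vec using (Vec; []; _∷_; lookup; tabulate)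
open import Data.List using (List; _∷_)
open import Data.List.Relation.Unary.All using (All)
open import Data.List.Relation.Unary.Any using (Any)
open import Data.Product using (Σ; ∃; ∃-syntax; _×_; _,_)
open import Data.Sum using (_⊎_)
open import Data.Empty using (⊥)
open import Data.Unit using (⊤)
open import Relation.Nullary using (¬_)
open import Relation.Nullary.Decidable using (⌊_⌋)
open import Relation.Binary.PropositionalEquality using (_≡_)
open import Function.Definitions using (Injective)
open import Function.Bundles using (_⇔_)
open import Algebra.Bundles using (CommutativeRing)

-- Structures (E , r).  The finite set E is represented as Fin n;
-- subsets of E are Data.Fin.Subset (Vec Bool n).

record Structure : Set where
  constructor mkStructure
  field
    size : ℕ
    rk   : Subset size → ℕ
open Structure public

IsMatroid : Structure → Set
IsMatroid (mkStructure n r) =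
  (∀ (X : Subset n) → r X ≤ ∣ X ∣) ×
  (∀ (X Y : Subset n) → X ⊆ Y → r X ≤ r Y) ×
  (∀ (X Y : Subset n) → r (X ∪ Y) + r (X ∩ Y) ≤ r X + r Y)

anyFin : ∀ {m} → (Fin m → Bool) → Bool
anyFin {zero}  f = false
anyFin {suc m} f = f zero ∨ anyFin (λ i → f (suc i))

image : ∀ {m n} → (Fin m → Fin n) → Subset m → Subset n
image {m} {n} ι X = tabulate (λ j → anyFin (λ i → ⌊ ι i ≟ j ⌋ ∧ lookup X i))

-- N = (m , r') is (isomorphic to) a minor M / C \ D of M = (n , r):
-- C is the contracted set, ι : Fin m → Fin n is an injective relabelling
-- of the ground set of N onto E(M) - (C ∪ D), disjoint from C, and
-- r'(X) = r(X ∪ C) - r(C), written additively.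

IsMinorOf : Structure → Structure → Set
IsMinorOf (mkStructure m r') (mkStructure n r) =
  Σ (Subset n) λ C → Σ (Fin m → Fin n) λ ι →
    Injective _≡_ _≡_ ι ×
    (∀ i → ι i ∉ C) ×
    (∀ (X : Subset m) → r' X + r C ≡ r (image ι X ∪ C))

IsProperMinorOf : Structure → Structure → Set
IsProperMinorOf N M = IsMinorOf N M × size N < size M

Isomorphic : Structure → Structure → Set
Isomorphic (mkStructure m r') (mkStructure n r) =
  m ≡ n × Σ (Fin m → Fin n) λ ι →
    Injective _≡_ _≡_ ι × (∀ (X : Subset m) → r' X ≡ r (image ι X))

record Field : Set₁ where
  field
    commRing : CommutativeRing 0ℓ 0ℓ
  open CommutativeRing commRing public
  field
    0≉1      : ¬ (0# ≈ 1#)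
    inverse  : ∀ x → ¬ (x ≈ 0#) → ∃[ y ] (x * y ≈ 1#)

IsFiniteField : Field → Set
IsFiniteField F = Σ ℕ λ q → Σ (Fin q → Carrier) λ f →
    (∀ x → ∃[ i ] (f i ≈ x)) × (∀ i j → f i ≈ f j → i ≡ j)
  where open Field F

module _ (F : Field) where
  open Field F using (Carrier; _≈_; 0#) renaming (_+_ to _+F_; _*_ to _*F_)

  sumF : ∀ {n} → (Fin n → Carrier) → Carrier
  sumF {zero}  f = 0#
  sumF {suc n} f = f zero +F sumF (λ i → f (suc i))

  LinIndep : ∀ {n d} → (Fin n → Fin d → Carrier) → Subset n → Set
  LinIndep {n} {d} v Y =
    ∀ (c : Fin n → Carrier) →
      (∀ i → i ∉ Y → c i ≈ 0#) →
      (∀ (k : Fin d) → sumF (λ i → c i *F v i k) ≈ 0#) →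
      ∀ i → i ∈ Y → c i ≈ 0#

  IsRepresentable : Structure → Set
  IsRepresentable M@(mkStructure n r) =
    IsMatroid M ×
    Σ ℕ λ d → Σ (Fin n → Fin d → Carrier) λ v →
      ∀ (X : Subset n) →
        (Σ (Subset n) λ Y → Y ⊆ X × LinIndep v Y × ∣ Y ∣ ≡ r X) ×
        (∀ (Y : Subset n) → Y ⊆ X → LinIndep v Y → ∣ Y ∣ ≤ r X)

  IsExcludedMinor : Structure → Set
  IsExcludedMinor N =
    IsMatroid N × ¬ IsRepresentable N ×
    (∀ N' → IsProperMinorOf N' N → IsRepresentable N')

  FinitelyManyExcludedMinors : Set
  FinitelyManyExcludedMinors =
    Σ (List Structure) λ L →
      ∀ N → IsExcludedMinor N → Any (Isomorphic N) L

RotasConjecture : Set₁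
RotasConjecture = ∀ (F : Field) → IsFiniteField F → FinitelyManyExcludedMinors F

-- Monadic second-order logic for matroids (scoped de Bruijn syntax):
-- Formula e s has e element variables and s set variables in scope.

data SetTerm (e s : ℕ) : Set where
  `E   : SetTerm e s
  `∅   : SetTerm e s
  svar : Fin s → SetTerm e s
  sing : Fin e → SetTerm e s
  compl : SetTerm e s → SetTerm e s
  _`∪_ : SetTerm e s → SetTerm e s → SetTerm e s
  _`∩_ : SetTerm e s → SetTerm e s → SetTerm e s

data IntTerm (e s : ℕ) : Set where
  const : ℕ → IntTerm e s
  card  : SetTerm e s → IntTerm e s
  rank  : SetTerm e s → IntTerm e s
  _`+_  : IntTerm e s → IntTerm e s → IntTerm e s

data Formula : ℕ → ℕ → Set where
  elEq   : ∀ {e s} → Fin e → Fin e → Formula e s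
  setEq  : ∀ {e s} → SetTerm e s → SetTerm e s → Formula e s
  sub    : ∀ {e s} → SetTerm e s → SetTerm e s → Formula e s
  intEq  : ∀ {e s} → IntTerm e s → IntTerm e s → Formula e s
  intLe  : ∀ {e s} → IntTerm e s → IntTerm e s → Formula e s
  mem    : ∀ {e s} → Fin e → SetTerm e s → Formula e s
  `¬_    : ∀ {e s} → Formula e s → Formula e s
  _`∨_   : ∀ {e s} → Formula e s → Formula e s → Formula e s
  _`∧_   : ∀ {e s} → Formula e s → Formula e s → Formula e s
  ∃e     : ∀ {e s} → Formula (suc e) s → Formula e s
  ∀e     : ∀ {e s} → Formula (suc e) s → Formula e s
  ∃s     : ∀ {e s} → Formula e (suc s) → Formula e s
  ∀s     : ∀ {e s} → Formula e (suc s) → Formula e s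

Sentence : Set
Sentence = Formula 0 0

module Semantics (n : ℕ) (r : Subset n → ℕ) where

  ⟦_⟧ˢ : ∀ {e s} → SetTerm e s → Vec (Fin n) e → Vec (Subset n) s → Subset n
  ⟦ `E ⟧ˢ ρ σ = Eˢ
  ⟦ `∅ ⟧ˢ ρ σ = ∅ˢ
  ⟦ svar j ⟧ˢ ρ σ = lookup σ j
  ⟦ sing i ⟧ˢ ρ σ = ⁅ lookup ρ i ⁆
  ⟦ compl t ⟧ˢ ρ σ = ∁ (⟦ t ⟧ˢ ρ σ)
  ⟦ t `∪ u ⟧ˢ ρ σ = ⟦ t ⟧ˢ ρ σ ∪ ⟦ u ⟧ˢ ρ σ
  ⟦ t `∩ u ⟧ˢ ρ σ = ⟦ t ⟧ˢ ρ σ ∩ ⟦ u ⟧ˢ ρ σ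

  ⟦_⟧ⁱ : ∀ {e s} → IntTerm e s → Vec (Fin n) e → Vec (Subset n) s → ℕ
  ⟦ const k ⟧ⁱ ρ σ = k
  ⟦ card t ⟧ⁱ ρ σ = ∣ ⟦ t ⟧ˢ ρ σ ∣
  ⟦ rank t ⟧ⁱ ρ σ = r (⟦ t ⟧ˢ ρ σ)
  ⟦ p `+ q ⟧ⁱ ρ σ = ⟦ p ⟧ⁱ ρ σ + ⟦ q ⟧ⁱ ρ σ

  ⟦_⟧ : ∀ {e s} → Formula e s → Vec (Fin n) e → Vec (Subset n) s → Set
  ⟦ elEq i j ⟧ ρ σ = lookup ρ i ≡ lookup ρ j
  ⟦ setEq t u ⟧ ρ σ = ⟦ t ⟧ˢ ρ σ ≡ ⟦ u ⟧ˢ ρ σ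
  ⟦ sub t u ⟧ ρ σ = ⟦ t ⟧ˢ ρ σ ⊆ ⟦ u ⟧ˢ ρ σ
  ⟦ intEq p q ⟧ ρ σ = ⟦ p ⟧ⁱ ρ σ ≡ ⟦ q ⟧ⁱ ρ σ
  ⟦ intLe p q ⟧ ρ σ = ⟦ p ⟧ⁱ ρ σ ≤ ⟦ q ⟧ⁱ ρ σ
  ⟦ mem i t ⟧ ρ σ = lookup ρ i ∈ ⟦ t ⟧ˢ ρ σ
  ⟦ `¬ φ ⟧ ρ σ = ¬ ⟦ φ ⟧ ρ σ
  ⟦ φ `∨ ψ ⟧ ρ σ = ⟦ φ ⟧ ρ σ ⊎ ⟦ ψ ⟧ ρ σ
  ⟦ φ `∧ ψ ⟧ ρ σ = ⟦ φ ⟧ ρ σ × ⟦ ψ ⟧ ρ σ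
  ⟦ ∃e φ ⟧ ρ σ = Σ (Fin n) λ x → ⟦ φ ⟧ (x ∷ ρ) σ
  ⟦ ∀e φ ⟧ ρ σ = ∀ (x : Fin n) → ⟦ φ ⟧ (x ∷ ρ) σ
  ⟦ ∃s φ ⟧ ρ σ = Σ (Subset n) λ X → ⟦ φ ⟧ ρ (X ∷ σ)
  ⟦ ∀s φ ⟧ ρ σ = ∀ (X : Subset n) → ⟦ φ ⟧ ρ (X ∷ σ)

Sat : Structure → Sentence → Set
Sat (mkStructure n r) φ = ⟦ φ ⟧ [] []
  where open Semantics n r

SatAll : Structure → List Sentence → Set
SatAll M Φ = All (Sat M) Φ

data Quant : Set where
  ∃q ∀q : Quant

quantE : Quant → ∀ {e s} → Formula (suc e) s → Formula e s
quantE ∃q = ∃e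
quantE ∀q = ∀e

quantS : Quant → ∀ {e s} → Formula e (suc s) → Formula e s
quantS ∃q = ∃s
quantS ∀q = ∀s

QuantifierFree : ∀ {e s} → Formula e s → Set
QuantifierFree (elEq _ _) = ⊤
QuantifierFree (setEq _ _) = ⊤
QuantifierFree (sub _ _) = ⊤
QuantifierFree (intEq _ _) = ⊤
QuantifierFree (intLe _ _) = ⊤
QuantifierFree (mem _ _) = ⊤
QuantifierFree (`¬ φ) = QuantifierFree φ
QuantifierFree (φ `∨ ψ) = QuantifierFree φ × QuantifierFree ψ
QuantifierFree (φ `∧ ψ) = QuantifierFree φ × QuantifierFree ψ
QuantifierFree (∃e _) = ⊥
QuantifierFree (∀e _) = ⊥
QuantifierFree (∃s _) = ⊥
QuantifierFree (∀s _) = ⊥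

data ElemBlock (q' : Quant) : ∀ {e s} → Formula e s → Set where
  qf   : ∀ {e s} {P : Formula e s} → QuantifierFree P → ElemBlock q' P
  step : ∀ {e s} {φ : Formula (suc e) s} → ElemBlock q' φ → ElemBlock q' (quantE q' φ)

data SetBlock (q q' : Quant) : ∀ {e s} → Formula e s → Set where
  elems : ∀ {e s} {φ : Formula e s} → ElemBlock q' φ → SetBlock q q' φ
  step  : ∀ {e s} {φ : Formula e (suc s)} → SetBlock q q' φ → SetBlock q q' (quantS q φ)

MPrenex : Sentence → Set
MPrenex φ = Σ Quant λ q → Σ Quant λ q' → SetBlock q q' φ

InMLogic : Sentence → Set
InMLogic φ = Σ Sentence λ ψ → MPrenex ψ × (∀ (M : Structure) → Sat M φ ⇔ Sat M ψ)

-- The sentences R1, R2, R3 (de Bruijn: svar zero is the innermost X).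

_`→_ : ∀ {e s} → Formula e s → Formula e s → Formula e s
φ `→ ψ = (`¬ φ) `∨ ψ

R1 : Sentence
R1 = ∀s (intLe (rank (svar zero)) (card (svar zero)))

-- ∀X1 ∀X2 . X1 ⊆ X2 → r(X1) ≤ r(X2);  X1 = svar (suc zero), X2 = svar zero
R2 : Sentence
R2 = ∀s (∀s (sub (svar (suc zero)) (svar zero)
              `→ intLe (rank (svar (suc zero))) (rank (svar zero))))

R3 : Sentence
R3 = ∀s (∀s (intLe (rank (svar (suc zero) `∪ svar zero) `+ rank (svar (suc zero) `∩ svar zero))
                   (rank (svar (suc zero)) `+ rank (svar zero))))

-- Representability over a field is closed under minors: contracting an element is one step of
-- Gaussian elimination with a pivot in its vector, and deleting elements just forgets vectors.
-- Over a finite field it is also decidable, since every representation row-reduces to one by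
-- n vectors in Fⁿ; so a non-representable matroid can be descended through non-representable
-- minors of decreasing size to an excluded minor.  Hence a matroid is representable iff it has
-- no minor isomorphic to a non-representable structure of Rota's finite list, and "no minor
-- isomorphic to L" is the M-logic sentence ∀C ∀x₁…x_k ¬φ with φ quantifier-free, stating that
-- the xᵢ are distinct elements outside C and r_L(S) + r(C) = r({xᵢ | i ∈ S} ∪ C) for all S ⊆ E(L).

module Submission where

open import Defs
open import Data.List using (List; []; _∷_; map; filter)
open import Data.List.Relation.Unary.All using (All; []; _∷_; universal; lookupAny) renaming (map to All-map)
open import Data.List.Relation.Unary.All.Properties
  using (all-filter) renaming (map⁺ to All-map⁺; map⁻ to All-map⁻; filter⁻ to All-filter⁻)
open import Data.List.Relation.Unary.Any using (Any) renaming (map to Any-map)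
open import Data.Product using (Σ; _×_; _,_; proj₁; proj₂; ∃; ∃-syntax)
open import Data.Sum using (_⊎_; inj₁; inj₂; [_,_])
open import Data.Empty using (⊥)
open import Data.Unit using (tt)
open import Data.Bool using (Bool; true; false; _∧_)
open import Data.Bool.Properties using (∨-zeroʳ)
open import Data.Nat using (ℕ; zero; suc; _+_; _∸_; _≤_; _<_)
open import Data.Nat.Properties
open import Data.Nat.Induction using (<-rec)
open import Data.Fin using (Fin; zero; suc; toℕ; fromℕ<; punchIn; punchOut)
import Data.Fin.Properties as Fin
open import Data.Fin.Subset
  using (Subset; ⁅_⁆; _∈_; _∉_; _⊆_; _∪_; _∩_; ∣_∣; _─_; _-_; inside; outside)
  renaming (⊥ to ∅ˢ)
open import Data.Fin.Subset.Properties
open import Data.Vec using (Vec; []; _∷_; lookup; tabulate; here; there)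
open import Data.Vec.Properties using (lookup∘tabulate; []=⇒lookup; lookup⇒[]=)
open import Function.Base using (_∘_; id)
open import Function.Bundles using (_⇔_; mk⇔; Equivalence)
open import Function.Properties.Equivalence using (⇔-setoid) renaming (sym to ⇔-sym)
open import Data.Product.Function.NonDependent.Propositional using (_×-⇔_)
open import Level using (0ℓ)
open import Function.Definitions using (Injective)
open import Relation.Nullary using (¬_; Dec; yes; no; contradiction)
open import Relation.Nullary.Decidable using (⌊_⌋; _×-dec_; _→-dec_; ¬?; decidable-stable; map′)
open import Relation.Binary.Definitions using (Decidable)
open import Relation.Binary.PropositionalEquality hiding ([_])
import Algebra.Bundles as Bundles
import Algebra.Properties.Ring as RingProperties
import Algebra.Properties.Semiring.Sum as SemiringSum
import Algebra.Solver.Ring.NaturalCoefficients.Default as NaturalCoefficientsSolver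
import Relation.Binary.Reasoning.Setoid as SetoidReasoning
import Algebra.Properties.CommutativeSemigroup as CommutativeSemigroupProperties

-- Finite subsets

∣p∪q∣+∣p∩q∣≡∣p∣+∣q∣ : ∀ {n} (p q : Subset n) → ∣ p ∪ q ∣ + ∣ p ∩ q ∣ ≡ ∣ p ∣ + ∣ q ∣
∣p∪q∣+∣p∩q∣≡∣p∣+∣q∣ []            []            = refl
∣p∪q∣+∣p∩q∣≡∣p∣+∣q∣ (inside ∷ p)  (inside ∷ q)  =
  cong suc (trans (+-suc _ _) (trans (cong suc (∣p∪q∣+∣p∩q∣≡∣p∣+∣q∣ p q)) (sym (+-suc _ _))))
∣p∪q∣+∣p∩q∣≡∣p∣+∣q∣ (inside ∷ p)  (outside ∷ q) = cong suc (∣p∪q∣+∣p∩q∣≡∣p∣+∣q∣ p q)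
∣p∪q∣+∣p∩q∣≡∣p∣+∣q∣ (outside ∷ p) (inside ∷ q)  =
  trans (cong suc (∣p∪q∣+∣p∩q∣≡∣p∣+∣q∣ p q)) (sym (+-suc _ _))
∣p∪q∣+∣p∩q∣≡∣p∣+∣q∣ (outside ∷ p) (outside ∷ q) = ∣p∪q∣+∣p∩q∣≡∣p∣+∣q∣ p q

p∩q≡∅ : ∀ {n} {p q : Subset n} → (∀ {x} → x ∈ p → x ∉ q) → p ∩ q ≡ ∅ˢ
p∩q≡∅ {p = p} {q} disjoint = Empty-unique λ (x , x∈p∩q) →
  let (x∈p , x∈q) = x∈p∩q⁻ p q x∈p∩q in disjoint x∈p x∈q

∣p∪⁅x⁆∣≡1+∣p∣ : ∀ {n} {p : Subset n} {x} → x ∉ p → ∣ p ∪ ⁅ x ⁆ ∣ ≡ suc ∣ p ∣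
∣p∪⁅x⁆∣≡1+∣p∣ {n} {p} {x} x∉p = begin
  ∣ p ∪ ⁅ x ⁆ ∣                  ≡⟨ +-identityʳ _ ⟨
  ∣ p ∪ ⁅ x ⁆ ∣ + 0              ≡⟨ cong (∣ p ∪ ⁅ x ⁆ ∣ +_) (∣⊥∣≡0 n) ⟨
  ∣ p ∪ ⁅ x ⁆ ∣ + ∣ ∅ˢ {n} ∣     ≡⟨ cong (λ s → ∣ p ∪ ⁅ x ⁆ ∣ + ∣ s ∣) p∩⁅x⁆≡∅ ⟨
  ∣ p ∪ ⁅ x ⁆ ∣ + ∣ p ∩ ⁅ x ⁆ ∣  ≡⟨ ∣p∪q∣+∣p∩q∣≡∣p∣+∣q∣ p ⁅ x ⁆ ⟩
  ∣ p ∣ + ∣ ⁅ x ⁆ ∣              ≡⟨ cong (∣ p ∣ +_) (∣⁅x⁆∣≡1 x) ⟩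
  ∣ p ∣ + 1                      ≡⟨ +-comm _ 1 ⟩
  suc ∣ p ∣                      ∎
  where
  open ≡-Reasoning
  p∩⁅x⁆≡∅ : p ∩ ⁅ x ⁆ ≡ ∅ˢ
  p∩⁅x⁆≡∅ = p∩q≡∅ λ y∈p y∈⁅x⁆ → x∉p (subst (_∈ p) (x∈⁅y⁆⇒x≡y x y∈⁅x⁆) y∈p)

x∈p─q⇒x∉q : ∀ {n} (p q : Subset n) {x} → x ∈ p ─ q → x ∉ q
x∈p─q⇒x∉q (_ ∷ p) (outside ∷ q) here       ()
x∈p─q⇒x∉q (_ ∷ p) (_ ∷ q)       (there x∈) (there x∈q) = x∈p─q⇒x∉q p q x∈ x∈q

x∉p-x : ∀ {n} (p : Subset n) x → x ∉ p - x
x∉p-x p x x∈ = x∈p─q⇒x∉q p ⁅ x ⁆ x∈ (x∈⁅x⁆ x)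

p-x∪⁅x⁆≡p : ∀ {n} {p : Subset n} {x} → x ∈ p → (p - x) ∪ ⁅ x ⁆ ≡ p
p-x∪⁅x⁆≡p {p = p} {x} x∈p = ⊆-antisym ⊆p p⊆
  where
  ⊆p : (p - x) ∪ ⁅ x ⁆ ⊆ p
  ⊆p y∈ with x∈p∪q⁻ (p - x) ⁅ x ⁆ y∈
  ... | inj₁ y∈p-x = p─q⊆p p ⁅ x ⁆ y∈p-x
  ... | inj₂ y∈⁅x⁆ = subst (_∈ p) (sym (x∈⁅y⁆⇒x≡y x y∈⁅x⁆)) x∈p
  p⊆ : p ⊆ (p - x) ∪ ⁅ x ⁆
  p⊆ {y} y∈p with y Fin.≟ x
  ... | yes refl = q⊆p∪q (p - x) ⁅ x ⁆ (x∈⁅x⁆ x)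
  ... | no y≢x   = p⊆p∪q ⁅ x ⁆ (x∈p∧x≢y⇒x∈p-y y∈p y≢x)

⊆⇒∪≡ : ∀ {n} {p q : Subset n} → p ⊆ q → q ∪ p ≡ q
⊆⇒∪≡ {p = p} {q} p⊆q = ⊆-antisym (λ x∈ → [ id , p⊆q ] (x∈p∪q⁻ q p x∈)) (p⊆p∪q p)

∪-interchange : ∀ {n} (X Y C : Subset n) → (X ∪ C) ∪ (Y ∪ C) ≡ (X ∪ Y) ∪ C
∪-interchange {n} X Y C = begin
  (X ∪ C) ∪ (Y ∪ C)  ≡⟨ CommutativeSemigroupProperties.interchange
                          (Bundles.CommutativeMonoid.commutativeSemigroup (∪-commutativeMonoid n)) X C Y C ⟩
  (X ∪ Y) ∪ (C ∪ C)  ≡⟨ cong ((X ∪ Y) ∪_) (∪-idem C) ⟩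
  (X ∪ Y) ∪ C        ∎
  where open ≡-Reasoning

∪-monoˡ : ∀ {n} {X Y Z : Subset n} → X ⊆ Y → X ∪ Z ⊆ Y ∪ Z
∪-monoˡ {X = X} {Y} {Z} X⊆Y x∈ = [ p⊆p∪q Z ∘ X⊆Y , q⊆p∪q Y Z ] (x∈p∪q⁻ X Z x∈)

subset-induction : ∀ {n} (P : Subset n → Set) → P ∅ˢ →
                   (∀ p x → x ∉ p → P p → P (p ∪ ⁅ x ⁆)) → ∀ p → P p
subset-induction {n} P P∅ P∪ p = <-rec (λ k → ∀ p → ∣ p ∣ ≡ k → P p) shrink ∣ p ∣ p refl
  where
  shrink : ∀ k → (∀ {j} → j < k → ∀ p → ∣ p ∣ ≡ j → P p) → ∀ p → ∣ p ∣ ≡ k → P p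
  shrink k rec p refl with nonempty? p
  ... | no  empty    = subst P (sym (Empty-unique empty)) P∅
  ... | yes (x , x∈p) = subst P (p-x∪⁅x⁆≡p x∈p)
    (P∪ (p - x) x (x∉p-x p x) (rec (x∈p⇒∣p-x∣<∣p∣ x∈p) (p - x) refl))

⊆-∣∣≥⇒≡ : ∀ {n} {p q : Subset n} → p ⊆ q → ∣ q ∣ ≤ ∣ p ∣ → p ≡ q
⊆-∣∣≥⇒≡ {p = p} {q} p⊆q ∣q∣≤∣p∣ = ⊆-antisym p⊆q q⊆p
  where
  q⊆p : q ⊆ p
  q⊆p {x} x∈q with x ∈? p
  ... | yes x∈p = x∈p
  ... | no  x∉p = contradiction ∣q∣≤∣p∣ (<⇒≱ (p⊂q⇒∣p∣<∣q∣ (p⊆q , x , x∈q , x∉p)))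

-- Images of subsets

anyFin-true⁻ : ∀ {m} (f : Fin m → Bool) → anyFin f ≡ true → ∃[ i ] f i ≡ true
anyFin-true⁻ {suc m} f any≡true with f zero in f0
... | true  = zero , f0
... | false = let (i , fi) = anyFin-true⁻ (f ∘ suc) any≡true in suc i , fi

anyFin-true⁺ : ∀ {m} (f : Fin m → Bool) i → f i ≡ true → anyFin f ≡ true
anyFin-true⁺ f zero    fi rewrite fi = refl
anyFin-true⁺ f (suc i) fi rewrite anyFin-true⁺ (f ∘ suc) i fi = ∨-zeroʳ (f zero)

module _ {m n : ℕ} (ι : Fin m → Fin n) where

  ∈image⁻ : ∀ X {j} → j ∈ image ι X → ∃[ i ] ι i ≡ j × i ∈ X
  ∈image⁻ X {j} j∈ with anyFin-true⁻ _ (trans (sym (lookup∘tabulate _ j)) ([]=⇒lookup j∈))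
  ... | i , ιi≟j∧i∈X with ι i Fin.≟ j | lookup X i in X[i]
  ...   | yes ιi≡j | true = i , ιi≡j , lookup⇒[]= i X X[i]

  ∈image⁺ : ∀ X {i} → i ∈ X → ι i ∈ image ι X
  ∈image⁺ X {i} i∈X = lookup⇒[]= (ι i) (image ι X)
    (trans (lookup∘tabulate _ (ι i))
           (anyFin-true⁺ _ i (cong₂ _∧_ (cong ⌊_⌋ (≡-≟-identity Fin._≟_ refl)) ([]=⇒lookup i∈X))))

  image-unique : ∀ {X Z} → (∀ {i} → i ∈ X → ι i ∈ Z) → (∀ {j} → j ∈ Z → ∃[ i ] ι i ≡ j × i ∈ X) →
                 image ι X ≡ Z
  image-unique {X} {Z} into onto = ⊆-antisym image⊆ ⊆image
    where
    image⊆ : image ι X ⊆ Z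
    image⊆ j∈ with ∈image⁻ X j∈
    ... | i , refl , i∈X = into i∈X
    ⊆image : Z ⊆ image ι X
    ⊆image j∈Z with onto j∈Z
    ... | i , refl , i∈X = ∈image⁺ X i∈X

  image-mono : ∀ {X Y} → X ⊆ Y → image ι X ⊆ image ι Y
  image-mono {X} {Y} X⊆Y j∈ with ∈image⁻ X j∈
  ... | i , refl , i∈X = ∈image⁺ Y (X⊆Y i∈X)

  image-∪ : ∀ X Y → image ι (X ∪ Y) ≡ image ι X ∪ image ι Y
  image-∪ X Y = image-unique
    (λ i∈ → [ p⊆p∪q _ ∘ ∈image⁺ X , q⊆p∪q _ _ ∘ ∈image⁺ Y ] (x∈p∪q⁻ X Y i∈))
    (λ j∈ → [ (λ j∈X → let (i , e , i∈) = ∈image⁻ X j∈X in i , e , p⊆p∪q Y i∈)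
            , (λ j∈Y → let (i , e , i∈) = ∈image⁻ Y j∈Y in i , e , q⊆p∪q X Y i∈)
            ] (x∈p∪q⁻ _ _ j∈))

  image-⁅⁆ : ∀ i → image ι ⁅ i ⁆ ≡ ⁅ ι i ⁆
  image-⁅⁆ i = image-unique
    (λ i′∈ → subst (λ k → ι k ∈ ⁅ ι i ⁆) (sym (x∈⁅y⁆⇒x≡y i i′∈)) (x∈⁅x⁆ (ι i)))
    (λ j∈ → i , sym (x∈⁅y⁆⇒x≡y (ι i) j∈) , x∈⁅x⁆ i)

  image-∅ : image ι ∅ˢ ≡ ∅ˢ
  image-∅ = image-unique (λ i∈ → contradiction i∈ ∉⊥) (λ j∈ → contradiction j∈ ∉⊥)

  module _ (ι-inj : Injective _≡_ _≡_ ι) where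

    ∈image-injective : ∀ X {i} → ι i ∈ image ι X → i ∈ X
    ∈image-injective X ιi∈ with ∈image⁻ X ιi∈
    ... | i′ , ιi′≡ιi , i′∈X = subst (_∈ X) (ι-inj ιi′≡ιi) i′∈X

    image-∩ : ∀ X Y → image ι (X ∩ Y) ≡ image ι X ∩ image ι Y
    image-∩ X Y = image-unique
      (λ i∈ → let (i∈X , i∈Y) = x∈p∩q⁻ X Y i∈ in x∈p∩q⁺ (∈image⁺ X i∈X , ∈image⁺ Y i∈Y))
      (λ j∈ → let (j∈X , j∈Y) = x∈p∩q⁻ _ _ j∈ ; (i , e , i∈X) = ∈image⁻ X j∈X in
        i , e , x∈p∩q⁺ (i∈X , ∈image-injective Y (subst (_∈ image ι Y) (sym e) j∈Y)))

    ∣image∣ : ∀ X → ∣ image ι X ∣ ≡ ∣ X ∣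
    ∣image∣ = subset-induction (λ X → ∣ image ι X ∣ ≡ ∣ X ∣)
      (trans (cong ∣_∣ image-∅) (trans (∣⊥∣≡0 n) (sym (∣⊥∣≡0 m))))
      λ X i i∉X ih → begin
        ∣ image ι (X ∪ ⁅ i ⁆) ∣           ≡⟨ cong ∣_∣ (image-∪ X ⁅ i ⁆) ⟩
        ∣ image ι X ∪ image ι ⁅ i ⁆ ∣     ≡⟨ cong (λ Z → ∣ image ι X ∪ Z ∣) (image-⁅⁆ i) ⟩
        ∣ image ι X ∪ ⁅ ι i ⁆ ∣           ≡⟨ ∣p∪⁅x⁆∣≡1+∣p∣ (i∉X ∘ ∈image-injective X) ⟩
        suc ∣ image ι X ∣                 ≡⟨ cong suc ih ⟩
        suc ∣ X ∣                         ≡⟨ ∣p∪⁅x⁆∣≡1+∣p∣ i∉X ⟨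
        ∣ X ∪ ⁅ i ⁆ ∣                     ∎
      where open ≡-Reasoning

  preimage : Subset n → Subset m
  preimage Z = tabulate (λ i → lookup Z (ι i))

  ∈preimage : ∀ Z {i} → i ∈ preimage Z ⇔ ι i ∈ Z
  ∈preimage Z {i} = mk⇔
    (λ i∈ → lookup⇒[]= (ι i) Z (trans (sym (lookup∘tabulate _ i)) ([]=⇒lookup i∈)))
    (λ ιi∈ → lookup⇒[]= i (preimage Z) (trans (lookup∘tabulate _ i) ([]=⇒lookup ιi∈)))

  image-preimage : ∀ X {Z} → Z ⊆ image ι X → image ι (preimage Z) ≡ Z
  image-preimage X {Z} Z⊆ = image-unique (Equivalence.to (∈preimage Z))
    (λ j∈Z → let (i , e , _) = ∈image⁻ X (Z⊆ j∈Z) in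
      i , e , Equivalence.from (∈preimage Z) (subst (_∈ Z) (sym e) j∈Z))

image-∘ : ∀ {k m n} (ι : Fin m → Fin n) (κ : Fin k → Fin m) X → image (ι ∘ κ) X ≡ image ι (image κ X)
image-∘ ι κ X = image-unique (ι ∘ κ) (∈image⁺ ι (image κ X) ∘ ∈image⁺ κ X) λ j∈ →
  let (i , ιi≡j , i∈) = ∈image⁻ ι (image κ X) j∈ ; (h , κh≡i , h∈X) = ∈image⁻ κ X i∈ in
  h , trans (cong ι κh≡i) ιi≡j , h∈X

image-cong : ∀ {m n} {ι κ : Fin m → Fin n} → (∀ i → ι i ≡ κ i) → ∀ X → image ι X ≡ image κ X
image-cong {ι = ι} {κ} ι≗κ X = image-unique ι (λ i∈ → subst (_∈ image κ X) (sym (ι≗κ _)) (∈image⁺ κ X i∈))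
  λ j∈ → let (i , κi≡j , i∈X) = ∈image⁻ κ X j∈ in i , trans (ι≗κ i) κi≡j , i∈X

image-outside∷ : ∀ {m n} (ι : Fin (suc m) → Fin n) X → image ι (outside ∷ X) ≡ image (ι ∘ suc) X
image-outside∷ ι X = image-unique ι (λ { (there i∈X) → ∈image⁺ (ι ∘ suc) X i∈X })
  λ j∈ → let (i , ιsi≡j , i∈X) = ∈image⁻ (ι ∘ suc) X j∈ in suc i , ιsi≡j , there i∈X

image-inside∷ : ∀ {m n} (ι : Fin (suc m) → Fin n) X → image ι (inside ∷ X) ≡ ⁅ ι zero ⁆ ∪ image (ι ∘ suc) X
image-inside∷ ι X = image-unique ι
  (λ { here → p⊆p∪q _ (x∈⁅x⁆ (ι zero)) ; (there i∈X) → q⊆p∪q _ _ (∈image⁺ (ι ∘ suc) X i∈X) })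
  λ j∈ → [ (λ j∈⁅ι0⁆ → zero , sym (x∈⁅y⁆⇒x≡y _ j∈⁅ι0⁆) , here)
         , (λ j∈ιX → let (i , ιsi≡j , i∈X) = ∈image⁻ (ι ∘ suc) X j∈ιX in suc i , ιsi≡j , there i∈X)
         ] (x∈p∪q⁻ _ _ j∈)

image-id : ∀ {n} (X : Subset n) → image id X ≡ X
image-id X = image-unique id id (λ {j} j∈X → j , refl , j∈X)

-- Matroid rank functions

+-interchange : ∀ a b c → (a + c) + (b + c) ≡ (a + b) + (c + c)
+-interchange a b c = CommutativeSemigroupProperties.interchange +-commutativeSemigroup a c b c

Independent : ∀ {n} → (Subset n → ℕ) → Subset n → Set
Independent r I = r I ≡ ∣ I ∣

contractionRank : ∀ {n} → (Subset n → ℕ) → Subset n → Subset n → ℕ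
contractionRank r C X = r (X ∪ C) ∸ r C

module MatroidRank {n} {r : Subset n → ℕ} (isMatroid : IsMatroid (mkStructure n r)) where

  r≤∣∣ : ∀ X → r X ≤ ∣ X ∣
  r≤∣∣ = proj₁ isMatroid

  r-mono : ∀ {X Y} → X ⊆ Y → r X ≤ r Y
  r-mono = proj₁ (proj₂ isMatroid) _ _

  r-submodular : ∀ X Y → r (X ∪ Y) + r (X ∩ Y) ≤ r X + r Y
  r-submodular = proj₂ (proj₂ isMatroid)

  r∅≡0 : r ∅ˢ ≡ 0
  r∅≡0 = n≤0⇒n≡0 (≤-trans (r≤∣∣ ∅ˢ) (≤-reflexive (∣⊥∣≡0 n)))

  r-∪≤ : ∀ X Y → r (X ∪ Y) ≤ r X + r Y
  r-∪≤ X Y = ≤-trans (m≤m+n _ _) (r-submodular X Y)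

  r-∪⁅⁆≤ : ∀ X x → r (X ∪ ⁅ x ⁆) ≤ suc (r X)
  r-∪⁅⁆≤ X x = begin
    r (X ∪ ⁅ x ⁆)    ≤⟨ r-∪≤ X ⁅ x ⁆ ⟩
    r X + r ⁅ x ⁆    ≤⟨ +-monoʳ-≤ (r X) (≤-trans (r≤∣∣ ⁅ x ⁆) (≤-reflexive (∣⁅x⁆∣≡1 x))) ⟩
    r X + 1          ≡⟨ +-comm (r X) 1 ⟩
    suc (r X)        ∎
    where open ≤-Reasoning

  spanning-∪ : ∀ {J X} Y → J ⊆ X → r J ≡ r X → r (X ∪ Y) ≤ r (J ∪ Y)
  spanning-∪ {J} {X} Y J⊆X rJ≡rX = +-cancelʳ-≤ (r X) _ _ (begin
    r (X ∪ Y) + r X                              ≡⟨ cong₂ _+_ (cong r X∪[J∪Y]≡X∪Y) rJ≡rX ⟨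
    r (X ∪ (J ∪ Y)) + r J                        ≤⟨ +-monoʳ-≤ _ (r-mono J⊆X∩[J∪Y]) ⟩
    r (X ∪ (J ∪ Y)) + r (X ∩ (J ∪ Y))            ≤⟨ r-submodular X (J ∪ Y) ⟩
    r X + r (J ∪ Y)                              ≡⟨ +-comm (r X) _ ⟩
    r (J ∪ Y) + r X                              ∎)
    where
    open ≤-Reasoning
    X∪[J∪Y]≡X∪Y : X ∪ (J ∪ Y) ≡ X ∪ Y
    X∪[J∪Y]≡X∪Y = trans (sym (∪-assoc X J Y)) (cong (_∪ Y) (⊆⇒∪≡ J⊆X))
    J⊆X∩[J∪Y] : J ⊆ X ∩ (J ∪ Y)
    J⊆X∩[J∪Y] x∈J = x∈p∩q⁺ (J⊆X x∈J , p⊆p∪q Y x∈J)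

  basis-extension : ∀ {I} → Independent r I → ∀ T →
    ∃[ J ] I ⊆ J × J ⊆ I ∪ T × Independent r J × r J ≡ r (I ∪ T)
  basis-extension {I} I-ind = subset-induction _
    (I , id , p⊆p∪q ∅ˢ , I-ind , cong r (sym (∪-identityʳ I)))
    λ T x _ (J , I⊆J , J⊆I∪T , J-ind , rJ≡) → extend T x J I⊆J J⊆I∪T J-ind rJ≡
    where
    extend : ∀ T x J → I ⊆ J → J ⊆ I ∪ T → Independent r J → r J ≡ r (I ∪ T) →
             ∃[ J′ ] I ⊆ J′ × J′ ⊆ I ∪ (T ∪ ⁅ x ⁆) × Independent r J′ × r J′ ≡ r (I ∪ (T ∪ ⁅ x ⁆))
    extend T x J I⊆J J⊆I∪T J-ind rJ≡ with r (J ∪ ⁅ x ⁆) ≟ suc (r J)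
    ... | yes rJx≡ = J ∪ ⁅ x ⁆ , p⊆p∪q _ ∘ I⊆J , Jx⊆ , Jx-ind , ≤-antisym (r-mono Jx⊆) rI∪Tx≤rJx
      where
      x∉J : x ∉ J
      x∉J x∈J = 1+n≢n (trans (sym rJx≡) (cong r (⊆⇒∪≡ λ y∈ → subst (_∈ J) (sym (x∈⁅y⁆⇒x≡y x y∈)) x∈J)))
      Jx⊆ : J ∪ ⁅ x ⁆ ⊆ I ∪ (T ∪ ⁅ x ⁆)
      Jx⊆ y∈ = [ (λ y∈J → subst (_ ∈_) (∪-assoc I T ⁅ x ⁆) (p⊆p∪q _ (J⊆I∪T y∈J))) , q⊆p∪q I _ ∘ q⊆p∪q T _ ]
                 (x∈p∪q⁻ J ⁅ x ⁆ y∈)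
      Jx-ind : Independent r (J ∪ ⁅ x ⁆)
      Jx-ind = trans rJx≡ (trans (cong suc J-ind) (sym (∣p∪⁅x⁆∣≡1+∣p∣ x∉J)))
      rI∪Tx≤rJx : r (I ∪ (T ∪ ⁅ x ⁆)) ≤ r (J ∪ ⁅ x ⁆)
      rI∪Tx≤rJx = subst (λ Z → r Z ≤ _) (∪-assoc I T ⁅ x ⁆) (spanning-∪ ⁅ x ⁆ J⊆I∪T rJ≡)
    ... | no rJx≢ = J , I⊆J , J⊆ , J-ind , ≤-antisym (r-mono J⊆) rI∪Tx≤rJ
      where
      J⊆ : J ⊆ I ∪ (T ∪ ⁅ x ⁆)
      J⊆ y∈J = subst (_ ∈_) (∪-assoc I T ⁅ x ⁆) (p⊆p∪q _ (J⊆I∪T y∈J))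
      rJx≡rJ : r (J ∪ ⁅ x ⁆) ≡ r J
      rJx≡rJ = ≤-antisym (m<1+n⇒m≤n (≤∧≢⇒< (r-∪⁅⁆≤ J x) rJx≢)) (r-mono (p⊆p∪q _))
      rI∪Tx≤rJ : r (I ∪ (T ∪ ⁅ x ⁆)) ≤ r J
      rI∪Tx≤rJ = subst (λ Z → r Z ≤ r J) (∪-assoc I T ⁅ x ⁆)
        (≤-trans (spanning-∪ ⁅ x ⁆ J⊆I∪T rJ≡) (≤-reflexive rJx≡rJ))

  contractionRank-+ : ∀ C X → contractionRank r C X + r C ≡ r (X ∪ C)
  contractionRank-+ C X = m∸n+n≡m (r-mono (q⊆p∪q X C))

  contraction-isMatroid : ∀ C {s : Subset n → ℕ} → (∀ X → s X + r C ≡ r (X ∪ C)) → IsMatroid (mkStructure n s)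
  contraction-isMatroid C {s} s-def = s≤∣∣ , (λ X Y → s-mono {X} {Y}) , s-submodular
    where
    open ≤-Reasoning
    s≤∣∣ : ∀ X → s X ≤ ∣ X ∣
    s≤∣∣ X = +-cancelʳ-≤ (r C) _ _ (begin
      s X + r C    ≡⟨ s-def X ⟩
      r (X ∪ C)    ≤⟨ r-∪≤ X C ⟩
      r X + r C    ≤⟨ +-monoˡ-≤ (r C) (r≤∣∣ X) ⟩
      ∣ X ∣ + r C  ∎)
    s-mono : ∀ {X Y} → X ⊆ Y → s X ≤ s Y
    s-mono {X} {Y} X⊆Y = +-cancelʳ-≤ (r C) _ _ (begin
      s X + r C    ≡⟨ s-def X ⟩
      r (X ∪ C)    ≤⟨ r-mono (∪-monoˡ X⊆Y) ⟩
      r (Y ∪ C)    ≡⟨ s-def Y ⟨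
      s Y + r C    ∎)
    s-submodular : ∀ X Y → s (X ∪ Y) + s (X ∩ Y) ≤ s X + s Y
    s-submodular X Y = +-cancelʳ-≤ (r C + r C) _ _ (begin
      (s (X ∪ Y) + s (X ∩ Y)) + (r C + r C)          ≡⟨ +-interchange (s (X ∪ Y)) _ (r C) ⟨
      (s (X ∪ Y) + r C) + (s (X ∩ Y) + r C)          ≡⟨ cong₂ _+_ (s-def (X ∪ Y)) (s-def (X ∩ Y)) ⟩
      r ((X ∪ Y) ∪ C) + r ((X ∩ Y) ∪ C)              ≡⟨ cong₂ _+_ (cong r (∪-interchange X Y C))
                                                                   (cong r (sym (∪-distribʳ-∩ C X Y))) ⟨
      r ((X ∪ C) ∪ (Y ∪ C)) + r ((X ∪ C) ∩ (Y ∪ C))  ≤⟨ r-submodular _ _ ⟩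
      r (X ∪ C) + r (Y ∪ C)                          ≡⟨ cong₂ _+_ (s-def X) (s-def Y) ⟨
      (s X + r C) + (s Y + r C)                      ≡⟨ +-interchange (s X) (s Y) (r C) ⟩
      (s X + s Y) + (r C + r C)                      ∎)

  relabel-isMatroid : ∀ {m} {ι : Fin m → Fin n} → Injective _≡_ _≡_ ι →
                      ∀ {s : Subset m → ℕ} → (∀ X → s X ≡ r (image ι X)) → IsMatroid (mkStructure m s)
  relabel-isMatroid {ι = ι} ι-inj {s} s-def = s≤∣∣ , (λ X Y → s-mono {X} {Y}) , s-submodular
    where
    open ≤-Reasoning
    s≤∣∣ : ∀ X → s X ≤ ∣ X ∣
    s≤∣∣ X = begin
      s X                ≡⟨ s-def X ⟩
      r (image ι X)      ≤⟨ r≤∣∣ (image ι X) ⟩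
      ∣ image ι X ∣      ≡⟨ ∣image∣ ι ι-inj X ⟩
      ∣ X ∣              ∎
    s-mono : ∀ {X Y} → X ⊆ Y → s X ≤ s Y
    s-mono {X} {Y} X⊆Y = begin
      s X                ≡⟨ s-def X ⟩
      r (image ι X)      ≤⟨ r-mono (image-mono ι X⊆Y) ⟩
      r (image ι Y)      ≡⟨ s-def Y ⟨
      s Y                ∎
    s-submodular : ∀ X Y → s (X ∪ Y) + s (X ∩ Y) ≤ s X + s Y
    s-submodular X Y = begin
      s (X ∪ Y) + s (X ∩ Y)                                  ≡⟨ cong₂ _+_ (trans (s-def _) (cong r (image-∪ ι X Y)))
                                                                          (trans (s-def _) (cong r (image-∩ ι ι-inj X Y))) ⟩
      r (image ι X ∪ image ι Y) + r (image ι X ∩ image ι Y)  ≤⟨ r-submodular _ _ ⟩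
      r (image ι X) + r (image ι Y)                          ≡⟨ cong₂ _+_ (s-def X) (s-def Y) ⟨
      s X + s Y                                              ∎

  minor-contractionRank : ∀ {m} {s : Subset m → ℕ} {C ι} → (∀ X → s X + r C ≡ r (image ι X ∪ C)) →
                          ∀ X → s X ≡ contractionRank r C (image ι X)
  minor-contractionRank {C = C} {ι} s-def X =
    +-cancelʳ-≡ (r C) _ _ (trans (s-def X) (sym (contractionRank-+ C (image ι X))))

-- Minors

minor-isMatroid : ∀ {N M} → IsMatroid M → IsMinorOf N M → IsMatroid N
minor-isMatroid {mkStructure m s} {mkStructure n r} M-mat (C , ι , ι-inj , _ , s-def) =
  MatroidRank.relabel-isMatroid (contraction-isMatroid C (contractionRank-+ C)) ι-inj (minor-contractionRank s-def)
  where open MatroidRank M-mat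

minor-trans : ∀ {A B M} → IsMinorOf A B → IsMinorOf B M → IsMinorOf A M
minor-trans {mkStructure k a} {mkStructure m b} {mkStructure n r}
            (D , κ , κ-inj , κ-avoids , a-def) (C , ι , ι-inj , ι-avoids , b-def) =
  image ι D ∪ C , ι ∘ κ , κ-inj ∘ ι-inj , avoids , a-def′
  where
  avoids : ∀ i → ι (κ i) ∉ image ι D ∪ C
  avoids i x∈ = [ κ-avoids i ∘ ∈image-injective ι ι-inj D , ι-avoids (κ i) ] (x∈p∪q⁻ (image ι D) C x∈)
  a-def′ : ∀ X → a X + r (image ι D ∪ C) ≡ r (image (ι ∘ κ) X ∪ (image ι D ∪ C))
  a-def′ X = begin
    a X + r (image ι D ∪ C)                      ≡⟨ cong (a X +_) (b-def D) ⟨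
    a X + (b D + r C)                            ≡⟨ +-assoc (a X) _ _ ⟨
    (a X + b D) + r C                            ≡⟨ cong (_+ r C) (a-def X) ⟩
    b (image κ X ∪ D) + r C                      ≡⟨ b-def _ ⟩
    r (image ι (image κ X ∪ D) ∪ C)              ≡⟨ cong (λ Z → r (Z ∪ C)) (image-∪ ι (image κ X) D) ⟩
    r ((image ι (image κ X) ∪ image ι D) ∪ C)    ≡⟨ cong r (∪-assoc _ _ C) ⟩
    r (image ι (image κ X) ∪ (image ι D ∪ C))    ≡⟨ cong (λ Z → r (Z ∪ (image ι D ∪ C))) (image-∘ ι κ X) ⟨
    r (image (ι ∘ κ) X ∪ (image ι D ∪ C))        ∎
    where open ≡-Reasoning

relabelling-isMinor : ∀ {m n} {s : Subset m → ℕ} {r : Subset n → ℕ} {ι : Fin m → Fin n} →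
  r ∅ˢ ≡ 0 → Injective _≡_ _≡_ ι → (∀ X → s X ≡ r (image ι X)) → IsMinorOf (mkStructure m s) (mkStructure n r)
relabelling-isMinor {s = s} {r} {ι} r∅≡0 ι-inj s-def = ∅ˢ , ι , ι-inj , (λ _ → ∉⊥) , λ X → begin
  s X + r ∅ˢ              ≡⟨ cong (s X +_) r∅≡0 ⟩
  s X + 0                 ≡⟨ +-identityʳ (s X) ⟩
  s X                     ≡⟨ s-def X ⟩
  r (image ι X)           ≡⟨ cong r (∪-identityʳ (image ι X)) ⟨
  r (image ι X ∪ ∅ˢ)      ∎
  where open ≡-Reasoning

minor-refl : ∀ {M} → IsMatroid M → IsMinorOf M M
minor-refl {mkStructure n r} M-mat =
  relabelling-isMinor (MatroidRank.r∅≡0 M-mat) id (λ X → cong r (sym (image-id X)))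

minorStructure : ∀ {m n} → (Subset n → ℕ) → Subset n → (Fin m → Fin n) → Structure
minorStructure {m} r C ι = mkStructure m (contractionRank r C ∘ image ι)

minorStructure-isMinor : ∀ {m n} {r : Subset n → ℕ} {C} {ι : Fin m → Fin n} → IsMatroid (mkStructure n r) →
                         Injective _≡_ _≡_ ι → (∀ i → ι i ∉ C) → IsMinorOf (minorStructure r C ι) (mkStructure n r)
minorStructure-isMinor {C = C} {ι} isMatroid ι-inj ι-avoids =
  C , ι , ι-inj , ι-avoids , λ X → MatroidRank.contractionRank-+ isMatroid C (image ι X)

injective⇒surjective : ∀ {n} {f : Fin n → Fin n} → Injective _≡_ _≡_ f → ∀ j → ∃[ i ] f i ≡ j
injective⇒surjective {suc n} {f} f-inj j with Fin.any? (λ i → f i Fin.≟ j)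
... | yes hit = hit
... | no  miss = contradiction (Fin.injective⇒≤ g-inj) (<-irrefl refl)
  where
  g : Fin (suc n) → Fin n
  g i = punchOut {i = j} {j = f i} (λ j≡fi → miss (i , sym j≡fi))
  g-inj : Injective _≡_ _≡_ g
  g-inj = f-inj ∘ Fin.punchOut-injective {i = j} _ _

isomorphic⇒minors : ∀ {N L} → IsMatroid N → Isomorphic N L → IsMinorOf N L × IsMinorOf L N
isomorphic⇒minors {mkStructure n s} {mkStructure .n r} N-mat (refl , ι , ι-inj , s-def) =
  relabelling-isMinor r∅≡0 ι-inj s-def ,
  relabelling-isMinor (MatroidRank.r∅≡0 N-mat) κ-inj r-def
  where
  r∅≡0 : r ∅ˢ ≡ 0
  r∅≡0 = trans (cong r (sym (image-∅ ι))) (trans (sym (s-def ∅ˢ)) (MatroidRank.r∅≡0 N-mat))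
  κ : Fin n → Fin n
  κ j = proj₁ (injective⇒surjective ι-inj j)
  ικ≗id : ∀ j → ι (κ j) ≡ j
  ικ≗id j = proj₂ (injective⇒surjective ι-inj j)
  κ-inj : Injective _≡_ _≡_ κ
  κ-inj {x} {y} κx≡κy = trans (sym (ικ≗id x)) (trans (cong ι κx≡κy) (ικ≗id y))
  r-def : ∀ Y → r Y ≡ s (image κ Y)
  r-def Y = begin
    r Y                    ≡⟨ cong r (trans (image-cong ικ≗id Y) (image-id Y)) ⟨
    r (image (ι ∘ κ) Y)    ≡⟨ cong r (image-∘ ι κ Y) ⟩
    r (image ι (image κ Y)) ≡⟨ s-def _ ⟨
    s (image κ Y)          ∎
    where open ≡-Reasoning

-- Linear algebra over a field

module LinearAlgebra (F : Field) where

  module F = Field F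
  open F public using (Carrier; _≈_; 0#; 1#; -_) renaming (_+_ to _+F_; _*_ to _*F_)
  open SemiringSum F.semiring
    using (sum; sum-cong-≋; sum-cong-≗; ∑-distrib-+; ∑-comm; *-distribʳ-sum; sum-replicate-zero; sum-remove)
  open NaturalCoefficientsSolver F.commutativeSemiring using (solve; _:+_; _:*_; _:=_)
  module ≈-Reasoning = SetoidReasoning (Field.setoid F)

  sumF≡sum : ∀ {n} (f : Fin n → Carrier) → sumF F f ≡ sum f
  sumF≡sum {zero}  f = refl
  sumF≡sum {suc n} f = cong (f zero +F_) (sumF≡sum (f ∘ suc))

  sumF-cong : ∀ {n} {f g : Fin n → Carrier} → (∀ i → f i ≈ g i) → sumF F f ≈ sumF F g
  sumF-cong {f = f} {g} f≈g = subst₂ _≈_ (sym (sumF≡sum f)) (sym (sumF≡sum g)) (sum-cong-≋ f≈g)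

  sumF-zero : ∀ {n} {f : Fin n → Carrier} → (∀ i → f i ≈ 0#) → sumF F f ≈ 0#
  sumF-zero {n} f≈0 = F.trans (sumF-cong f≈0) (subst (_≈ 0#) (sym (sumF≡sum {n} (λ _ → 0#))) (sum-replicate-zero n))

  sumF-+ : ∀ {n} (f g : Fin n → Carrier) → sumF F (λ i → f i +F g i) ≈ sumF F f +F sumF F g
  sumF-+ f g =
    subst₂ _≈_ (sym (sumF≡sum (λ i → f i +F g i))) (sym (cong₂ _+F_ (sumF≡sum f) (sumF≡sum g))) (∑-distrib-+ f g)

  sumF-*ʳ : ∀ {n} (f : Fin n → Carrier) x → sumF F (λ i → f i *F x) ≈ sumF F f *F x
  sumF-*ʳ f x = subst₂ _≈_ (sym (sumF≡sum (λ i → f i *F x))) (sym (cong (_*F x) (sumF≡sum f))) (F.sym (*-distribʳ-sum x f))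

  sumF-comm : ∀ {m n} (f : Fin m → Fin n → Carrier) →
              sumF F (λ j → sumF F (λ i → f i j)) ≈ sumF F (λ i → sumF F (λ j → f i j))
  sumF-comm f = subst₂ _≈_ (sym (nested (λ j i → f i j))) (sym (nested f)) (F.sym (∑-comm f))
    where
    nested : ∀ {m n} (g : Fin m → Fin n → Carrier) → sumF F (λ i → sumF F (g i)) ≡ sum (λ i → sum (g i))
    nested g = trans (sumF≡sum (λ i → sumF F (g i))) (sum-cong-≗ (λ i → sumF≡sum (g i)))

  sumF-single : ∀ {n} (f : Fin n → Carrier) i → (∀ j → j ≢ i → f j ≈ 0#) → sumF F f ≈ f i
  sumF-single {suc n} f i off-i≈0 = begin
    sumF F f                    ≡⟨ sumF≡sum f ⟩
    sum f                       ≈⟨ sum-remove f ⟩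
    f i +F sum (f ∘ punchIn i)  ≈⟨ F.+-cong F.refl (F.trans (sum-cong-≋ (λ j → off-i≈0 _ (Fin.punchInᵢ≢i i j)))
                                                          (sum-replicate-zero n)) ⟩
    f i +F 0#                   ≈⟨ F.+-identityʳ (f i) ⟩
    f i                         ∎
    where open ≈-Reasoning

  combination : ∀ {n d} → (Fin n → Carrier) → (Fin n → Fin d → Carrier) → Fin d → Carrier
  combination c v k = sumF F (λ i → c i *F v i k)

  IsRelation : ∀ {n d} → (Fin n → Fin d → Carrier) → (Fin n → Carrier) → Set
  IsRelation v c = ∀ k → combination c v k ≈ 0#

  SameRelations : ∀ {n d d′} → (Fin n → Fin d → Carrier) → (Fin n → Fin d′ → Carrier) → Set
  SameRelations v w = ∀ c → IsRelation v c ⇔ IsRelation w c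

  combination-+ : ∀ {n d} (c c′ : Fin n → Carrier) (v : Fin n → Fin d → Carrier) k →
                  combination (λ i → c i +F c′ i) v k ≈ combination c v k +F combination c′ v k
  combination-+ c c′ v k =
    F.trans (sumF-cong (λ i → F.distribʳ (v i k) (c i) (c′ i))) (sumF-+ (λ i → c i *F v i k) (λ i → c′ i *F v i k))

  δ : ∀ {n} → Fin n → Carrier → Fin n → Carrier
  δ i x j with j Fin.≟ i
  ... | yes _ = x
  ... | no  _ = 0#

  δ-diag : ∀ {n} (i : Fin n) x → δ i x i ≈ x
  δ-diag i x rewrite ≡-≟-identity Fin._≟_ (refl {x = i}) = F.refl

  δ-off : ∀ {n} {i j : Fin n} x → j ≢ i → δ i x j ≈ 0#
  δ-off x j≢i rewrite ≢-≟-identity Fin._≟_ j≢i = F.refl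

  combination-δ : ∀ {n d} i x (v : Fin n → Fin d → Carrier) k → combination (δ i x) v k ≈ x *F v i k
  combination-δ i x v k = F.trans (sumF-single _ i (λ j j≢i → F.trans (F.*-cong (δ-off x j≢i) F.refl) (F.zeroˡ _)))
                                  (F.*-cong (δ-diag i x) F.refl)

  ≈⇒SameRelations : ∀ {n d} {v w : Fin n → Fin d → Carrier} → (∀ i k → v i k ≈ w i k) → SameRelations v w
  ≈⇒SameRelations v≈w c = mk⇔
    (λ rel k → F.trans (sumF-cong (λ i → F.*-cong F.refl (F.sym (v≈w i k)))) (rel k))
    (λ rel k → F.trans (sumF-cong (λ i → F.*-cong F.refl (v≈w i k))) (rel k))

  LinIndep-SameRelations : ∀ {n d d′} {v : Fin n → Fin d → Carrier} {w : Fin n → Fin d′ → Carrier} →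
                           SameRelations v w → ∀ Y → LinIndep F v Y → LinIndep F w Y
  LinIndep-SameRelations same Y v-ind c c-out w-rel = v-ind c c-out (Equivalence.from (same c) w-rel)

  zero-vector⇒¬LinIndep : ∀ {n d} {v : Fin n → Fin d → Carrier} {e Y} →
                          (∀ k → v e k ≈ 0#) → e ∈ Y → ¬ LinIndep F v Y
  zero-vector⇒¬LinIndep {v = v} {e} {Y} ve≈0 e∈Y v-ind =
    F.0≉1 (F.sym (F.trans (F.sym (δ-diag e 1#)) (v-ind (δ e 1#) off-Y rel e e∈Y)))
    where
    off-Y : ∀ i → i ∉ Y → δ e 1# i ≈ 0#
    off-Y i i∉Y = δ-off {j = i} 1# (λ { refl → i∉Y e∈Y })
    rel : IsRelation v (δ e 1#)
    rel k = F.trans (combination-δ e 1# v k) (F.trans (F.*-identityˡ _) (ve≈0 k))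

  -1# : Carrier
  -1# = - 1#

  x+-1#*x≈0 : ∀ x → x +F -1# *F x ≈ 0#
  x+-1#*x≈0 x = F.trans (F.+-cong F.refl (RingProperties.-1*x≈-x F.ring x)) (F.-‿inverseʳ x)

  -- One step of Gaussian elimination with pivot v e k₀, where a is its inverse: afterwards column k₀ and v e vanish.
  module Pivot {n d} (v : Fin n → Fin d → Carrier) (e : Fin n) (k₀ : Fin d) {a} (va≈1 : v e k₀ *F a ≈ 1#) where

    eliminated : Fin n → Fin d → Carrier
    eliminated i k = v i k +F -1# *F ((v i k₀ *F a) *F v e k)

    weight : (Fin n → Carrier) → Carrier
    weight c = combination c v k₀ *F a

    eliminated-e≈0 : ∀ k → eliminated e k ≈ 0#
    eliminated-e≈0 k = F.trans (F.+-cong F.refl (F.*-cong F.refl (F.trans (F.*-cong va≈1 F.refl) (F.*-identityˡ _))))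
                               (x+-1#*x≈0 (v e k))

    -- −1 is an opaque constant here, so these are commutative-semiring identities.
    combination-eliminated : ∀ c k → combination c eliminated k ≈ combination c v k +F -1# *F (weight c *F v e k)
    combination-eliminated c k = begin
      combination c eliminated k
        ≈⟨ sumF-cong (λ i → distribute (c i) (v i k) (v i k₀) a (v e k) -1#) ⟩
      sumF F (λ i → c i *F v i k +F (c i *F v i k₀) *F (-1# *F (a *F v e k)))
        ≈⟨ sumF-+ (λ i → c i *F v i k) _ ⟩
      combination c v k +F sumF F (λ i → (c i *F v i k₀) *F (-1# *F (a *F v e k)))
        ≈⟨ F.+-cong F.refl (sumF-*ʳ (λ i → c i *F v i k₀) _) ⟩
      combination c v k +F combination c v k₀ *F (-1# *F (a *F v e k))
        ≈⟨ regroup (combination c v k) (combination c v k₀) -1# a (v e k) ⟩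
      combination c v k +F -1# *F (weight c *F v e k)  ∎
      where
      open ≈-Reasoning
      distribute : ∀ c x y a z m → c *F (x +F m *F ((y *F a) *F z)) ≈ c *F x +F (c *F y) *F (m *F (a *F z))
      distribute = solve 6 (λ c x y a z m → c :* (x :+ m :* ((y :* a) :* z)) := c :* x :+ (c :* y) :* (m :* (a :* z))) F.refl
      regroup : ∀ L L₀ m a z → L +F L₀ *F (m *F (a *F z)) ≈ L +F m *F ((L₀ *F a) *F z)
      regroup = solve 5 (λ L L₀ m a z → L :+ L₀ :* (m :* (a :* z)) := L :+ m :* ((L₀ :* a) :* z)) F.refl

    weight≈0⇒combination≈ : ∀ c → weight c ≈ 0# → ∀ k → combination c eliminated k ≈ combination c v k
    weight≈0⇒combination≈ c w≈0 k = F.trans (combination-eliminated c k)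
      (F.trans (F.+-cong F.refl (F.trans (F.*-cong F.refl (F.trans (F.*-cong w≈0 F.refl) (F.zeroˡ _))) (F.zeroʳ _)))
               (F.+-identityʳ _))

    IsRelation-eliminated : ∀ c → IsRelation v c ⇔ (weight c ≈ 0# × IsRelation eliminated c)
    IsRelation-eliminated c = mk⇔
      (λ rel → let w≈0 = F.trans (F.*-cong (rel k₀) F.refl) (F.zeroˡ a) in
               w≈0 , λ k → F.trans (weight≈0⇒combination≈ c w≈0 k) (rel k))
      (λ (w≈0 , rel) k → F.trans (F.sym (weight≈0⇒combination≈ c w≈0 k)) (rel k))

    module _ {Y} (e∉Y : e ∉ Y) where
      private
        ∉Y∪e : ∀ {j} → j ∉ Y → j ≢ e → j ∉ Y ∪ ⁅ e ⁆
        ∉Y∪e j∉Y j≢e j∈ = [ j∉Y , j≢e ∘ x∈⁅y⁆⇒x≡y e ] (x∈p∪q⁻ Y ⁅ e ⁆ j∈)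
        ≢e : ∀ {i} → i ∈ Y → i ≢ e
        ≢e i∈Y refl = e∉Y i∈Y
        shift : ∀ (c : Fin n → Carrier) x {i} → i ∈ Y → c i +F δ e x i ≈ c i
        shift c x i∈Y = F.trans (F.+-cong F.refl (δ-off x (≢e i∈Y))) (F.+-identityʳ _)

      LinIndep-eliminated⇒ : LinIndep F eliminated Y → LinIndep F v (Y ∪ ⁅ e ⁆)
      LinIndep-eliminated⇒ elim-ind c c-out v-rel i i∈ =
        [ c≈0-on-Y , (λ i∈⁅e⁆ → subst (λ j → c j ≈ 0#) (sym (x∈⁅y⁆⇒x≡y e i∈⁅e⁆)) ce≈0) ]
          (x∈p∪q⁻ Y ⁅ e ⁆ i∈)
        where
        w≈0 = proj₁ (Equivalence.to (IsRelation-eliminated c) v-rel)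
        elim-rel = proj₂ (Equivalence.to (IsRelation-eliminated c) v-rel)
        c′ : Fin n → Carrier
        c′ i = c i +F δ e (-1# *F c e) i
        c′-rel : IsRelation eliminated c′
        c′-rel k = F.trans (combination-+ c _ eliminated k)
          (F.trans (F.+-cong (elim-rel k) (F.trans (combination-δ e _ eliminated k)
                                                   (F.trans (F.*-cong F.refl (eliminated-e≈0 k)) (F.zeroʳ _))))
                   (F.+-identityʳ 0#))
        c′-out : ∀ j → j ∉ Y → c′ j ≈ 0#
        c′-out j j∉Y with j Fin.≟ e
        ... | yes refl = x+-1#*x≈0 (c e)
        ... | no  j≢e  = F.trans (F.+-identityʳ _) (c-out j (∉Y∪e j∉Y j≢e))
        c≈0-on-Y : ∀ {i} → i ∈ Y → c i ≈ 0#
        c≈0-on-Y {i} i∈Y = F.trans (F.sym (shift c _ i∈Y)) (elim-ind c′ c′-out c′-rel i i∈Y)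
        ce≈0 : c e ≈ 0#
        ce≈0 = begin
          c e                          ≈⟨ F.*-identityʳ (c e) ⟨
          c e *F 1#                    ≈⟨ F.*-cong F.refl va≈1 ⟨
          c e *F (v e k₀ *F a)         ≈⟨ F.*-assoc (c e) _ _ ⟨
          (c e *F v e k₀) *F a         ≈⟨ F.*-cong (sumF-single (λ i → c i *F v i k₀) e c≈0-off-e) F.refl ⟨
          weight c                     ≈⟨ w≈0 ⟩
          0#                           ∎
          where
          open ≈-Reasoning
          c≈0-off-e : ∀ j → j ≢ e → c j *F v j k₀ ≈ 0#
          c≈0-off-e j j≢e with j ∈? Y
          ... | yes j∈Y = F.trans (F.*-cong (c≈0-on-Y j∈Y) F.refl) (F.zeroˡ _)
          ... | no  j∉Y = F.trans (F.*-cong (c-out j (∉Y∪e j∉Y j≢e)) F.refl) (F.zeroˡ _)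

      LinIndep-eliminated⇐ : LinIndep F v (Y ∪ ⁅ e ⁆) → LinIndep F eliminated Y
      LinIndep-eliminated⇐ v-ind c c-out elim-rel i i∈Y =
        F.trans (F.sym (shift c _ i∈Y)) (v-ind c′ c′-out c′-rel i (p⊆p∪q ⁅ e ⁆ i∈Y))
        where
        c′ : Fin n → Carrier
        c′ i = c i +F δ e (-1# *F weight c) i
        c′-rel : IsRelation v c′
        c′-rel k = begin
          combination c′ v k                                  ≈⟨ combination-+ c _ v k ⟩
          combination c v k +F combination (δ e _) v k        ≈⟨ F.+-cong F.refl (F.trans (combination-δ e _ v k)
                                                                                            (F.*-assoc _ _ _)) ⟩
          combination c v k +F -1# *F (weight c *F v e k)     ≈⟨ combination-eliminated c k ⟨
          combination c eliminated k                          ≈⟨ elim-rel k ⟩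
          0#                                                  ∎
          where open ≈-Reasoning
        c′-out : ∀ j → j ∉ Y ∪ ⁅ e ⁆ → c′ j ≈ 0#
        c′-out j j∉ = F.trans (F.+-cong (c-out j (j∉ ∘ p⊆p∪q ⁅ e ⁆))
                                        (δ-off _ (j∉ ∘ q⊆p∪q Y ⁅ e ⁆ ∘ Equivalence.from x∈⁅y⁆⇔x≡y)))
                              (F.+-identityʳ 0#)

    LinIndep-eliminated : ∀ Y → e ∉ Y → LinIndep F eliminated Y ⇔ LinIndep F v (Y ∪ ⁅ e ⁆)
    LinIndep-eliminated Y e∉Y = mk⇔ (LinIndep-eliminated⇒ e∉Y) (LinIndep-eliminated⇐ e∉Y)

  module _ {m n d} (w : Fin n → Fin d → Carrier) {ι : Fin m → Fin n} (ι-inj : Injective _≡_ _≡_ ι) where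

    push : (Fin m → Carrier) → Fin n → Carrier
    push c j = sumF F (λ i → δ (ι i) (c i) j)

    combination-push : ∀ c k → combination (push c) w k ≈ combination c (w ∘ ι) k
    combination-push c k = begin
      sumF F (λ j → sumF F (λ i → δ (ι i) (c i) j) *F w j k)   ≈⟨ sumF-cong (λ j → F.sym (sumF-*ʳ (λ i → δ (ι i) (c i) j) _)) ⟩
      sumF F (λ j → sumF F (λ i → δ (ι i) (c i) j *F w j k))   ≈⟨ sumF-comm (λ i j → δ (ι i) (c i) j *F w j k) ⟩
      sumF F (λ i → combination (δ (ι i) (c i)) w k)           ≈⟨ sumF-cong (λ i → combination-δ (ι i) (c i) w k) ⟩
      combination c (w ∘ ι) k                                  ∎
      where open ≈-Reasoning

    push-ι : ∀ c i → push c (ι i) ≈ c i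
    push-ι c i = F.trans (sumF-single _ i (λ i′ i′≢i → δ-off _ (i′≢i ∘ ι-inj ∘ sym))) (δ-diag (ι i) (c i))

    push-∉range : ∀ c {j} → (∀ i → ι i ≢ j) → push c j ≈ 0#
    push-∉range c j∉range = sumF-zero (λ i → δ-off _ (j∉range i ∘ sym))

    LinIndep-relabel : ∀ Y → LinIndep F (w ∘ ι) Y ⇔ LinIndep F w (image ι Y)
    LinIndep-relabel Y = mk⇔ to from
      where
      to : LinIndep F (w ∘ ι) Y → LinIndep F w (image ι Y)
      to wι-ind c c-out rel j j∈ with ∈image⁻ ι Y j∈
      ... | i , refl , i∈Y = wι-ind (c ∘ ι) (λ i i∉Y → c-out (ι i) (i∉Y ∘ ∈image-injective ι ι-inj Y)) wι-rel i i∈Y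
        where
        push≈c : ∀ j → push (c ∘ ι) j ≈ c j
        push≈c j with Fin.any? (λ i → ι i Fin.≟ j)
        ... | yes (i , refl) = push-ι (c ∘ ι) i
        ... | no  ∉range     = F.trans (push-∉range (c ∘ ι) (λ i ιi≡j → ∉range (i , ιi≡j)))
                                       (F.sym (c-out j (λ j∈ → let (i , ιi≡j , _) = ∈image⁻ ι Y j∈ in ∉range (i , ιi≡j))))
        wι-rel : IsRelation (w ∘ ι) (c ∘ ι)
        wι-rel k = F.trans (F.sym (combination-push (c ∘ ι) k))
                           (F.trans (sumF-cong (λ j → F.*-cong (push≈c j) F.refl)) (rel k))
      from : LinIndep F w (image ι Y) → LinIndep F (w ∘ ι) Y
      from w-ind c c-out rel i i∈Y =
        F.trans (F.sym (push-ι c i))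
                (w-ind (push c) push-out (λ k → F.trans (combination-push c k) (rel k)) (ι i) (∈image⁺ ι Y i∈Y))
        where
        push-out : ∀ j → j ∉ image ι Y → push c j ≈ 0#
        push-out j j∉ with Fin.any? (λ i → ι i Fin.≟ j)
        ... | yes (i , refl) = F.trans (push-ι c i) (c-out i (j∉ ∘ ∈image⁺ ι Y))
        ... | no  ∉range     = push-∉range c (λ i ιi≡j → ∉range (i , ιi≡j))

  RepresentedBy : ∀ {n d} → (Fin n → Fin d → Carrier) → (Subset n → ℕ) → Set
  RepresentedBy {n} v r = ∀ X →
    (Σ (Subset n) λ Y → Y ⊆ X × LinIndep F v Y × ∣ Y ∣ ≡ r X) × (∀ Y → Y ⊆ X → LinIndep F v Y → ∣ Y ∣ ≤ r X)

  RepresentedBy-SameRelations : ∀ {n d d′} {v : Fin n → Fin d → Carrier} {w : Fin n → Fin d′ → Carrier} {r} →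
                                SameRelations v w → RepresentedBy v r → RepresentedBy w r
  RepresentedBy-SameRelations same v-rep X =
    (let (Y , Y⊆X , Y-ind , ∣Y∣≡) = proj₁ (v-rep X) in Y , Y⊆X , LinIndep-SameRelations same Y Y-ind , ∣Y∣≡) ,
    (λ Y Y⊆X Y-ind → proj₂ (v-rep X) Y Y⊆X (LinIndep-SameRelations (λ c → ⇔-sym (same c)) Y Y-ind))

  RepresentedBy-≗ : ∀ {n d} {v : Fin n → Fin d → Carrier} {r s} →
                    (∀ X → r X ≡ s X) → RepresentedBy v r → RepresentedBy v s
  RepresentedBy-≗ r≗s v-rep X =
    (let (Y , Y⊆X , Y-ind , ∣Y∣≡) = proj₁ (v-rep X) in Y , Y⊆X , Y-ind , trans ∣Y∣≡ (r≗s X)) ,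
    (λ Y Y⊆X Y-ind → subst (∣ Y ∣ ≤_) (r≗s X) (proj₂ (v-rep X) Y Y⊆X Y-ind))

  IsRepresentable-≗ : ∀ {n} {r s : Subset n → ℕ} → (∀ X → r X ≡ s X) →
                      IsRepresentable F (mkStructure n r) → IsRepresentable F (mkStructure n s)
  IsRepresentable-≗ {r = r} r≗s (isMatroid , d , v , v-rep) =
    MatroidRank.relabel-isMatroid isMatroid id (λ X → trans (sym (r≗s X)) (cong r (sym (image-id X)))) ,
    d , v , RepresentedBy-≗ r≗s v-rep

  Independent⇔LinIndep : ∀ {n d} {r : Subset n → ℕ} {v : Fin n → Fin d → Carrier} → IsMatroid (mkStructure n r) →
                         RepresentedBy v r → ∀ Y → Independent r Y ⇔ LinIndep F v Y
  Independent⇔LinIndep isMatroid v-rep Y = mk⇔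
    (λ rY≡∣Y∣ → let (Z , Z⊆Y , Z-ind , ∣Z∣≡) = proj₁ (v-rep Y) in
      subst (LinIndep F _) (⊆-∣∣≥⇒≡ Z⊆Y (≤-reflexive (trans (sym rY≡∣Y∣) (sym ∣Z∣≡)))) Z-ind)
    (λ Y-ind → ≤-antisym (MatroidRank.r≤∣∣ isMatroid Y) (proj₂ (v-rep Y) Y id Y-ind))

  RepresentedBy-relabel : ∀ {m n d} {w : Fin n → Fin d → Carrier} {s : Subset n → ℕ} {r : Subset m → ℕ} {ι} →
    RepresentedBy w s → Injective _≡_ _≡_ ι → (∀ X → r X ≡ s (image ι X)) → RepresentedBy (w ∘ ι) r
  RepresentedBy-relabel {w = w} {s} {r} {ι} w-rep ι-inj r-def X = lower , upper
    where
    lower : Σ _ λ Y → Y ⊆ X × LinIndep F (w ∘ ι) Y × ∣ Y ∣ ≡ r X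
    lower with proj₁ (w-rep (image ι X))
    ... | Z , Z⊆ιX , Z-ind , ∣Z∣≡ =
      preimage ι Z ,
      (λ i∈ → ∈image-injective ι ι-inj X (Z⊆ιX (Equivalence.to (∈preimage ι Z) i∈))) ,
      Equivalence.from (LinIndep-relabel w ι-inj (preimage ι Z)) (subst (LinIndep F w) (sym ιpreZ≡Z) Z-ind) ,
      trans (sym (∣image∣ ι ι-inj (preimage ι Z))) (trans (cong ∣_∣ ιpreZ≡Z) (trans ∣Z∣≡ (sym (r-def X))))
      where
      ιpreZ≡Z = image-preimage ι X Z⊆ιX
    upper : ∀ Y → Y ⊆ X → LinIndep F (w ∘ ι) Y → ∣ Y ∣ ≤ r X
    upper Y Y⊆X Y-ind = subst₂ _≤_ (∣image∣ ι ι-inj Y) (sym (r-def X))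
      (proj₂ (w-rep (image ι X)) (image ι Y) (image-mono ι Y⊆X) (Equivalence.to (LinIndep-relabel w ι-inj Y) Y-ind))

  Representation : ∀ {n} → (Subset n → ℕ) → Set
  Representation {n} r = Σ ℕ λ d → Σ (Fin n → Fin d → Carrier) λ v → RepresentedBy v r

  module _ {n d} {r : Subset n → ℕ} {v : Fin n → Fin d → Carrier}
           (isMatroid : IsMatroid (mkStructure n r)) (v-rep : RepresentedBy v r)
           {e} {s : Subset n → ℕ} (s-def : ∀ X → s X + r ⁅ e ⁆ ≡ r (X ∪ ⁅ e ⁆)) where
    open MatroidRank isMatroid

    RepresentedBy-contract-loop : (∀ k → v e k ≈ 0#) → RepresentedBy v s
    RepresentedBy-contract-loop ve≈0 = RepresentedBy-≗ r≡s v-rep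
      where
      r⁅e⁆≢1 : r ⁅ e ⁆ ≢ 1
      r⁅e⁆≢1 r⁅e⁆≡1 = zero-vector⇒¬LinIndep ve≈0 (x∈⁅x⁆ e)
        (Equivalence.to (Independent⇔LinIndep isMatroid v-rep ⁅ e ⁆) (trans r⁅e⁆≡1 (sym (∣⁅x⁆∣≡1 e))))
      r⁅e⁆≡0 : r ⁅ e ⁆ ≡ 0
      r⁅e⁆≡0 = n≤0⇒n≡0 (m<1+n⇒m≤n (≤∧≢⇒< (≤-trans (r≤∣∣ ⁅ e ⁆) (≤-reflexive (∣⁅x⁆∣≡1 e))) r⁅e⁆≢1))
      r≡s : ∀ X → r X ≡ s X
      r≡s X = ≤-antisym
        (≤-trans (r-mono (p⊆p∪q ⁅ e ⁆))
                 (≤-reflexive (trans (sym (s-def X)) (trans (cong (s X +_) r⁅e⁆≡0) (+-identityʳ _)))))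
        (+-cancelʳ-≤ (r ⁅ e ⁆) _ _ (≤-trans (≤-reflexive (s-def X)) (r-∪≤ X ⁅ e ⁆)))

    module _ {k₀ a} (va≈1 : v e k₀ *F a ≈ 1#) where
      open Pivot v e k₀ va≈1

      private
        LinIndep⁅e⁆ : LinIndep F v ⁅ e ⁆
        LinIndep⁅e⁆ = subst (LinIndep F v) (∪-identityˡ ⁅ e ⁆)
          (Equivalence.to (LinIndep-eliminated ∅ˢ ∉⊥) (λ _ _ _ _ i∈∅ → contradiction i∈∅ ∉⊥))
        Independent⁅e⁆ : Independent r ⁅ e ⁆
        Independent⁅e⁆ = Equivalence.from (Independent⇔LinIndep isMatroid v-rep ⁅ e ⁆) LinIndep⁅e⁆
        s-def′ : ∀ X → suc (s X) ≡ r (X ∪ ⁅ e ⁆)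
        s-def′ X = trans (+-comm 1 (s X)) (trans (cong (s X +_) (sym (trans Independent⁅e⁆ (∣⁅x⁆∣≡1 e)))) (s-def X))

      -- A basis J of X ∪ e containing e gives the basis J − e of X in the contraction.
      eliminated-basis : ∀ X → Σ _ λ Y → Y ⊆ X × LinIndep F eliminated Y × ∣ Y ∣ ≡ s X
      eliminated-basis X with basis-extension Independent⁅e⁆ X
      ... | J , ⁅e⁆⊆J , J⊆ , J-ind , rJ≡ = J - e , J-e⊆X , J-e-ind , suc-injective ∣J-e∣+1≡
        where
        e∈J = ⁅e⁆⊆J (x∈⁅x⁆ e)
        J-e⊆X : J - e ⊆ X
        J-e⊆X x∈ = [ (λ x∈⁅e⁆ → contradiction (subst (_∈ J - e) (x∈⁅y⁆⇒x≡y e x∈⁅e⁆) x∈) (x∉p-x J e)) , id ]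
                     (x∈p∪q⁻ ⁅ e ⁆ X (J⊆ (p─q⊆p J ⁅ e ⁆ x∈)))
        J-e-ind : LinIndep F eliminated (J - e)
        J-e-ind = Equivalence.from (LinIndep-eliminated (J - e) (x∉p-x J e))
          (subst (LinIndep F v) (sym (p-x∪⁅x⁆≡p e∈J)) (Equivalence.to (Independent⇔LinIndep isMatroid v-rep J) J-ind))
        ∣J-e∣+1≡ : suc ∣ J - e ∣ ≡ suc (s X)
        ∣J-e∣+1≡ = begin
          suc ∣ J - e ∣          ≡⟨ ∣p∪⁅x⁆∣≡1+∣p∣ (x∉p-x J e) ⟨
          ∣ (J - e) ∪ ⁅ e ⁆ ∣    ≡⟨ cong ∣_∣ (p-x∪⁅x⁆≡p e∈J) ⟩
          ∣ J ∣                  ≡⟨ J-ind ⟨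
          r J                    ≡⟨ rJ≡ ⟩
          r (⁅ e ⁆ ∪ X)          ≡⟨ cong r (∪-comm ⁅ e ⁆ X) ⟩
          r (X ∪ ⁅ e ⁆)          ≡⟨ s-def′ X ⟨
          suc (s X)              ∎
          where open ≡-Reasoning

      eliminated-independent≤ : ∀ X Y → Y ⊆ X → LinIndep F eliminated Y → ∣ Y ∣ ≤ s X
      eliminated-independent≤ X Y Y⊆X Y-ind = m<1+n⇒m≤n (begin-strict
        ∣ Y ∣                  <⟨ n<1+n ∣ Y ∣ ⟩
        suc ∣ Y ∣              ≡⟨ ∣p∪⁅x⁆∣≡1+∣p∣ e∉Y ⟨
        ∣ Y ∪ ⁅ e ⁆ ∣          ≤⟨ proj₂ (v-rep (X ∪ ⁅ e ⁆)) (Y ∪ ⁅ e ⁆) (∪-monoˡ Y⊆X)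
                                        (Equivalence.to (LinIndep-eliminated Y e∉Y) Y-ind) ⟩
        r (X ∪ ⁅ e ⁆)          ≡⟨ s-def′ X ⟨
        suc (s X)              ∎)
        where
        open ≤-Reasoning
        e∉Y : e ∉ Y
        e∉Y e∈Y = zero-vector⇒¬LinIndep eliminated-e≈0 e∈Y Y-ind

      RepresentedBy-contract-pivot : RepresentedBy eliminated s
      RepresentedBy-contract-pivot X = eliminated-basis X , eliminated-independent≤ X

  module WithDecidableEquality (_≈?_ : Decidable _≈_) where

    zero-or-pivot : ∀ {d} (u : Fin d → Carrier) → (∀ k → u k ≈ 0#) ⊎ ∃[ k ] ¬ u k ≈ 0#
    zero-or-pivot u with Fin.any? (λ k → ¬? (u k ≈? 0#))
    ... | yes pivot = inj₂ pivot
    ... | no  none  = inj₁ λ k → decidable-stable (u k ≈? 0#) (λ uk≉0 → none (k , uk≉0))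

    IsRelation-tail : ∀ {n d} {v : Fin (suc n) → Fin d → Carrier} → (∀ k → v zero k ≈ 0#) →
                      ∀ c → IsRelation v c ⇔ IsRelation (v ∘ suc) (c ∘ suc)
    IsRelation-tail v0≈0 c = mk⇔ (λ rel k → F.trans (F.sym (drop k)) (rel k)) (λ rel k → F.trans (drop k) (rel k))
      where
      drop = λ k → F.trans (F.+-cong (F.trans (F.*-cong F.refl (v0≈0 k)) (F.zeroʳ _)) F.refl) (F.+-identityˡ _)

    bordered : ∀ {n} → Carrier → (Fin n → Carrier) → (Fin n → Fin n → Carrier) → Fin (suc n) → Fin (suc n) → Carrier
    bordered t s w zero    zero    = t
    bordered t s w zero    (suc k) = 0#
    bordered t s w (suc i) zero    = s i
    bordered t s w (suc i) (suc k) = w i k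

    IsRelation-bordered : ∀ {n} t s (w : Fin n → Fin n → Carrier) c →
      IsRelation (bordered t s w) c ⇔ ((c zero *F t +F sumF F (λ i → c (suc i) *F s i) ≈ 0#) × IsRelation w (c ∘ suc))
    IsRelation-bordered t s w c = mk⇔
      (λ rel → rel zero , λ k → F.trans (F.sym (drop k)) (rel (suc k)))
      (λ { (first , rel) zero → first ; (first , rel) (suc k) → F.trans (drop k) (rel k) })
      where
      drop = λ k → F.trans (F.+-cong (F.zeroʳ (c zero)) F.refl) (F.+-identityˡ (combination (c ∘ suc) w k))

    reduceDimension : ∀ {n d} (v : Fin n → Fin d → Carrier) → Σ (Fin n → Fin n → Carrier) (SameRelations v)
    reduceDimension {zero}  v = (λ ()) , λ c → mk⇔ (λ _ ()) (λ _ _ → F.refl)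
    reduceDimension {suc n} v with zero-or-pivot (v zero)
    ... | inj₁ v0≈0 = bordered 0# (λ _ → 0#) w , same
      where
      w = proj₁ (reduceDimension (v ∘ suc))
      same : SameRelations v (bordered 0# (λ _ → 0#) w)
      same c = begin
        IsRelation v c                                  ≈⟨ IsRelation-tail {v = v} v0≈0 c ⟩
        IsRelation (v ∘ suc) (c ∘ suc)                  ≈⟨ proj₂ (reduceDimension (v ∘ suc)) (c ∘ suc) ⟩
        IsRelation w (c ∘ suc)                          ≈⟨ mk⇔ (trivial ,_) proj₂ ⟩
        ((_ ≈ 0#) × IsRelation w (c ∘ suc))             ≈⟨ IsRelation-bordered 0# (λ _ → 0#) w c ⟨
        IsRelation (bordered 0# (λ _ → 0#) w) c         ∎
        where
        open SetoidReasoning (⇔-setoid 0ℓ)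
        trivial = F.trans (F.+-cong (F.zeroʳ (c zero)) (sumF-zero (λ i → F.zeroʳ (c (suc i))))) (F.+-identityˡ 0#)
    ... | inj₂ (k₀ , v0k₀≉0) with F.inverse (v zero k₀) v0k₀≉0
    ...   | a , va≈1 = bordered 1# β w , same
      where
      open Pivot v zero k₀ va≈1
      β : Fin n → Carrier
      β i = v (suc i) k₀ *F a
      w = proj₁ (reduceDimension (eliminated ∘ suc))
      weight≈ : ∀ c → weight c ≈ c zero *F 1# +F sumF F (λ i → c (suc i) *F β i)
      weight≈ c = F.trans (F.distribʳ a (c zero *F v zero k₀) _)
        (F.+-cong (F.trans (F.*-assoc _ _ _) (F.*-cong F.refl va≈1))
                  (F.trans (F.sym (sumF-*ʳ (λ i → c (suc i) *F v (suc i) k₀) a))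
                           (sumF-cong (λ i → F.*-assoc (c (suc i)) (v (suc i) k₀) a))))
      same : SameRelations v (bordered 1# β w)
      same c = begin
        IsRelation v c                                                   ≈⟨ IsRelation-eliminated c ⟩
        ((weight c ≈ 0#) × IsRelation eliminated c)                      ≈⟨ mk⇔ (F.trans (F.sym (weight≈ c))) (F.trans (weight≈ c))
                                                                              ×-⇔ IsRelation-tail {v = eliminated} eliminated-e≈0 c ⟩
        ((_ ≈ 0#) × IsRelation (eliminated ∘ suc) (c ∘ suc))             ≈⟨ mk⇔ id id
                                                                              ×-⇔ proj₂ (reduceDimension (eliminated ∘ suc)) (c ∘ suc) ⟩
        ((_ ≈ 0#) × IsRelation w (c ∘ suc))                              ≈⟨ IsRelation-bordered 1# β w c ⟨
        IsRelation (bordered 1# β w) c                                   ∎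
        where open SetoidReasoning (⇔-setoid 0ℓ)

    representation-contract⁅⁆ : ∀ {n d} {r : Subset n → ℕ} {v : Fin n → Fin d → Carrier} →
      IsMatroid (mkStructure n r) → RepresentedBy v r →
      ∀ e {s} → (∀ X → s X + r ⁅ e ⁆ ≡ r (X ∪ ⁅ e ⁆)) → Representation s
    representation-contract⁅⁆ {d = d} {v = v} isMatroid v-rep e s-def with zero-or-pivot (v e)
    ... | inj₁ ve≈0 = d , v , RepresentedBy-contract-loop isMatroid v-rep s-def ve≈0
    ... | inj₂ (k₀ , vek₀≉0) with F.inverse (v e k₀) vek₀≉0
    ...   | _ , va≈1 = d , Pivot.eliminated v e k₀ va≈1 , RepresentedBy-contract-pivot isMatroid v-rep s-def va≈1

    representation-contract : ∀ {n} {r : Subset n → ℕ} → IsMatroid (mkStructure n r) → Representation r →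
                              ∀ C {s} → (∀ X → s X + r C ≡ r (X ∪ C)) → Representation s
    representation-contract {n} {r} isMatroid (d , v , v-rep) = subset-induction P base extend
      where
      open MatroidRank isMatroid
      P : Subset n → Set
      P C = ∀ {s} → (∀ X → s X + r C ≡ r (X ∪ C)) → Representation s
      base : P ∅ˢ
      base {s} s-def = d , v , RepresentedBy-≗ r≡s v-rep
        where
        r≡s : ∀ X → r X ≡ s X
        r≡s X = begin
          r X             ≡⟨ cong r (∪-identityʳ X) ⟨
          r (X ∪ ∅ˢ)      ≡⟨ s-def X ⟨
          s X + r ∅ˢ      ≡⟨ cong (s X +_) r∅≡0 ⟩
          s X + 0         ≡⟨ +-identityʳ (s X) ⟩
          s X             ∎
          where open ≡-Reasoning
      extend : ∀ C a → a ∉ C → P C → P (C ∪ ⁅ a ⁆)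
      extend C a _ ih {s} s-def =
        let (_ , _ , v′-rep) = ih (contractionRank-+ C) in
        representation-contract⁅⁆ (contraction-isMatroid C (contractionRank-+ C)) v′-rep a s-def′
        where
        r/C = contractionRank r C
        s-def′ : ∀ X → s X + r/C ⁅ a ⁆ ≡ r/C (X ∪ ⁅ a ⁆)
        s-def′ X = +-cancelʳ-≡ (r C) _ _ (begin
          (s X + r/C ⁅ a ⁆) + r C      ≡⟨ +-assoc (s X) _ _ ⟩
          s X + (r/C ⁅ a ⁆ + r C)      ≡⟨ cong (s X +_) (trans (contractionRank-+ C ⁅ a ⁆) (cong r (∪-comm ⁅ a ⁆ C))) ⟩
          s X + r (C ∪ ⁅ a ⁆)          ≡⟨ s-def X ⟩
          r (X ∪ (C ∪ ⁅ a ⁆))          ≡⟨ cong (λ Z → r (X ∪ Z)) (∪-comm C ⁅ a ⁆) ⟩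
          r (X ∪ (⁅ a ⁆ ∪ C))          ≡⟨ cong r (∪-assoc X ⁅ a ⁆ C) ⟨
          r ((X ∪ ⁅ a ⁆) ∪ C)          ≡⟨ contractionRank-+ C (X ∪ ⁅ a ⁆) ⟨
          r/C (X ∪ ⁅ a ⁆) + r C        ∎)
          where open ≡-Reasoning

    minor-isRepresentable : ∀ {N M} → IsRepresentable F M → IsMinorOf N M → IsRepresentable F N
    minor-isRepresentable {mkStructure m s} {mkStructure n r} (isMatroid , rep) N≤M@(C , ι , ι-inj , _ , s-def) =
      let (d , w , w-rep) = representation-contract isMatroid rep C (contractionRank-+ C) in
      minor-isMatroid isMatroid N≤M , d , w ∘ ι , RepresentedBy-relabel w-rep ι-inj (minor-contractionRank s-def)
      where open MatroidRank isMatroid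

-- Exhaustive search

Searchable : (A : Set) → (A → A → Set) → Set₁
Searchable A _~_ = ∀ (P : A → Set) → (∀ {a b} → a ~ b → P a → P b) → (∀ a → Dec (P a)) → Dec (∃ P)

searchable-Fin : ∀ {n} → Searchable (Fin n) _≡_
searchable-Fin P _ P? = Fin.any? P?

searchable-Subset : ∀ {n} → Searchable (Subset n) _≡_
searchable-Subset P _ P? = anySubset? P?

searchable⇒all? : ∀ {A _~_} → Searchable A _~_ → (∀ {a b} → a ~ b → b ~ a) →
                  ∀ (P : A → Set) → (∀ {a b} → a ~ b → P a → P b) → (∀ a → Dec (P a)) → Dec (∀ a → P a)
searchable⇒all? search ~-sym P P-resp P? with search (¬_ ∘ P) (λ a~b ¬Pa Pb → ¬Pa (P-resp (~-sym a~b) Pb)) (¬? ∘ P?)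
... | yes (a , ¬Pa) = no (λ ∀P → ¬Pa (∀P a))
... | no  ∄¬P       = yes (λ a → decidable-stable (P? a) (λ ¬Pa → ∄¬P (a , ¬Pa)))

searchable-→ : ∀ {A _~_} → Searchable A _~_ → (∀ {a} → a ~ a) →
               ∀ n → Searchable (Fin n → A) (λ f g → ∀ i → f i ~ g i)
searchable-→ search ~-refl zero    P P-resp P? with P? (λ ())
... | yes P[] = yes ((λ ()) , P[])
... | no ¬P[] = no (λ (f , Pf) → ¬P[] (P-resp (λ ()) Pf))
searchable-→ {A} {_~_} search ~-refl (suc n) P P-resp P? with search Q Q-resp Q?
  where
  _◂_ : A → (Fin n → A) → Fin (suc n) → A
  (a ◂ f) zero    = a
  (a ◂ f) (suc i) = f i
  Q : A → Set
  Q a = ∃[ f ] P (a ◂ f)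
  Q-resp : ∀ {a b} → a ~ b → Q a → Q b
  Q-resp a~b (f , Pf) = f , P-resp (λ { zero → a~b ; (suc i) → ~-refl }) Pf
  Q? : ∀ a → Dec (Q a)
  Q? a = searchable-→ search ~-refl n (P ∘ (a ◂_)) (λ f~g → P-resp (λ { zero → ~-refl ; (suc i) → f~g i })) (P? ∘ (a ◂_))
... | yes (a , f , Pf) = yes (_ , Pf)
... | no  ∄Q           = no (λ (f , Pf) → ∄Q (f zero , f ∘ suc , P-resp (λ { zero → ~-refl ; (suc i) → ~-refl }) Pf))

allSubsets? : ∀ {n} (P : Subset n → Set) → (∀ X → Dec (P X)) → Dec (∀ X → P X)
allSubsets? P = searchable⇒all? searchable-Subset sym P (λ { refl PX → PX })

-- Deciding representability over a finite field

module FiniteField (F : Field) (finite : IsFiniteField F) where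

  open LinearAlgebra F
  private
    enum = proj₁ (proj₂ finite)
    enum-onto = proj₁ (proj₂ (proj₂ finite))
    enum-injective = proj₂ (proj₂ (proj₂ finite))

  _≈?_ : Decidable _≈_
  x ≈? y with enum-onto x | enum-onto y
  ... | i , ei≈x | j , ej≈y = map′
    (λ { refl → F.trans (F.sym ei≈x) ej≈y })
    (λ x≈y → enum-injective i j (F.trans ei≈x (F.trans x≈y (F.sym ej≈y))))
    (i Fin.≟ j)

  open WithDecidableEquality _≈?_ public

  searchable-Carrier : Searchable Carrier _≈_
  searchable-Carrier P P-resp P? with Fin.any? (P? ∘ enum)
  ... | yes (i , P[ei]) = yes (enum i , P[ei])
  ... | no  ∄i          = no λ (x , Px) → let (i , ei≈x) = enum-onto x in ∄i (i , P-resp (F.sym ei≈x) Px)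

  LinIndep? : ∀ {n d} (w : Fin n → Fin d → Carrier) Y → Dec (LinIndep F w Y)
  LinIndep? {n} w Y = searchable⇒all? (searchable-→ searchable-Carrier F.refl n) (λ c≈c′ i → F.sym (c≈c′ i))
    Kills Kills-resp Kills?
    where
    Kills : (Fin n → Carrier) → Set
    Kills c = (∀ i → i ∉ Y → c i ≈ 0#) → IsRelation w c → ∀ i → i ∈ Y → c i ≈ 0#
    Kills-resp : ∀ {c c′} → (∀ i → c i ≈ c′ i) → Kills c → Kills c′
    Kills-resp c≈c′ kills c′-out c′-rel i i∈Y = F.trans (F.sym (c≈c′ i))
      (kills (λ j j∉Y → F.trans (c≈c′ j) (c′-out j j∉Y))
             (λ k → F.trans (sumF-cong (λ j → F.*-cong (c≈c′ j) F.refl)) (c′-rel k)) i i∈Y)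
    Kills? : ∀ c → Dec (Kills c)
    Kills? c = Fin.all? (λ i → ¬? (i ∈? Y) →-dec (c i ≈? 0#))
         →-dec (Fin.all? (λ k → combination c w k ≈? 0#)
         →-dec Fin.all? (λ i → (i ∈? Y) →-dec (c i ≈? 0#)))

  RepresentedBy? : ∀ {n d} (w : Fin n → Fin d → Carrier) (r : Subset n → ℕ) → Dec (RepresentedBy w r)
  RepresentedBy? w r = allSubsets? _ λ X →
    anySubset? (λ Y → (Y ⊆? X) ×-dec LinIndep? w Y ×-dec (∣ Y ∣ ≟ r X)) ×-dec
    allSubsets? _ (λ Y → (Y ⊆? X) →-dec (LinIndep? w Y →-dec (∣ Y ∣ ≤? r X)))

  IsMatroid? : ∀ M → Dec (IsMatroid M)
  IsMatroid? (mkStructure n r) =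
    allSubsets? _ (λ X → r X ≤? ∣ X ∣) ×-dec
    allSubsets? _ (λ X → allSubsets? _ (λ Y → (X ⊆? Y) →-dec (r X ≤? r Y))) ×-dec
    allSubsets? _ (λ X → allSubsets? _ (λ Y → r (X ∪ Y) + r (X ∩ Y) ≤? r X + r Y))

  -- By reduceDimension it suffices to search among families of n vectors in Fⁿ.
  IsRepresentable? : ∀ M → Dec (IsRepresentable F M)
  IsRepresentable? M@(mkStructure n r) with IsMatroid? M
  ... | no ¬M-mat = no (¬M-mat ∘ proj₁)
  ... | yes M-mat with searchable-→ (searchable-→ searchable-Carrier F.refl n) (λ _ → F.refl) n
                         (λ w → RepresentedBy w r)
                         (λ w≈w′ → RepresentedBy-SameRelations (≈⇒SameRelations w≈w′))
                         (λ w → RepresentedBy? w r)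
  ...   | yes (w , w-rep) = yes (M-mat , n , w , w-rep)
  ...   | no ∄w           = no λ (_ , d , v , v-rep) →
    let (w , same) = reduceDimension v in ∄w (w , RepresentedBy-SameRelations same v-rep)

  NonRepresentableMinor : ∀ {n} → (Subset n → ℕ) → ℕ → Set
  NonRepresentableMinor {n} r m = Σ (Subset n) λ C → Σ (Fin m → Fin n) λ ι →
    (∀ i j → ι i ≡ ι j → i ≡ j) × (∀ i → ι i ∉ C) × ¬ IsRepresentable F (minorStructure r C ι)

  NonRepresentableMinor? : ∀ {n} (r : Subset n → ℕ) m → Dec (NonRepresentableMinor r m)
  NonRepresentableMinor? {n} r m = anySubset? λ C → searchable-→ searchable-Fin refl m (Embeds C) (Embeds-resp C) (Embeds? C)
    where
    Embeds : Subset n → (Fin m → Fin n) → Set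
    Embeds C ι = (∀ i j → ι i ≡ ι j → i ≡ j) × (∀ i → ι i ∉ C) × ¬ IsRepresentable F (minorStructure r C ι)
    Embeds-resp : ∀ C {ι ι′} → (∀ i → ι i ≡ ι′ i) → Embeds C ι → Embeds C ι′
    Embeds-resp C {ι} {ι′} ι≗ι′ (ι-inj , ι-avoids , ¬rep) =
      (λ i j ι′i≡ι′j → ι-inj i j (trans (ι≗ι′ i) (trans ι′i≡ι′j (sym (ι≗ι′ j))))) ,
      (λ i → ι-avoids i ∘ subst (_∈ C) (sym (ι≗ι′ i))) ,
      ¬rep ∘ IsRepresentable-≗ (λ X → cong (contractionRank r C) (sym (image-cong ι≗ι′ X)))
    Embeds? : ∀ C ι → Dec (Embeds C ι)
    Embeds? C ι = Fin.all? (λ i → Fin.all? (λ j → (ι i Fin.≟ ι j) →-dec (i Fin.≟ j))) ×-dec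
                  Fin.all? (λ i → ¬? (ι i ∈? C)) ×-dec
                  ¬? (IsRepresentable? (minorStructure r C ι))

  -- Descend through non-representable minors of decreasing size; one with no smaller such minor is excluded.
  excludedMinor-or-representable : ∀ M → IsMatroid M →
                                   IsRepresentable F M ⊎ ∃[ N ] IsExcludedMinor F N × IsMinorOf N M
  excludedMinor-or-representable (mkStructure n r) = <-rec P descend n r
    where
    P : ℕ → Set
    P n = ∀ (r : Subset n → ℕ) → IsMatroid (mkStructure n r) →
          IsRepresentable F (mkStructure n r) ⊎ ∃[ N ] IsExcludedMinor F N × IsMinorOf N (mkStructure n r)
    descend : ∀ n → (∀ {m} → m < n → P m) → P n
    descend n rec r isMatroid with IsRepresentable? (mkStructure n r)
    ... | yes rep = inj₁ rep
    ... | no ¬rep with Fin.any? (λ (m : Fin n) → NonRepresentableMinor? r (toℕ m))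
    ...   | yes (m , C , ι , ι-inj , ι-avoids , ¬rep′) =
      let N′≤M = minorStructure-isMinor isMatroid (λ {i} {j} → ι-inj i j) ι-avoids in
      [ (λ rep′ → contradiction rep′ ¬rep′)
      , (λ (N , excluded , N≤N′) → inj₂ (N , excluded , minor-trans {N} {minorStructure r C ι} N≤N′ N′≤M))
      ] (rec (Fin.toℕ<n m) _ (minor-isMatroid isMatroid N′≤M))
    ...   | no ∄minor = inj₂ (mkStructure n r , (isMatroid , ¬rep , proper-minors-representable) , minor-refl isMatroid)
      where
      proper-minors-representable : ∀ N′ → IsProperMinorOf N′ (mkStructure n r) → IsRepresentable F N′
      proper-minors-representable N′@(mkStructure m s) ((C , ι , ι-inj , ι-avoids , s-def) , m<n)
        with IsRepresentable? N′
      ... | yes rep′ = rep′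
      ... | no ¬rep′ = contradiction (fromℕ< m<n , subst (NonRepresentableMinor r) (sym (Fin.toℕ-fromℕ< m<n)) minor) ∄minor
        where
        minor : NonRepresentableMinor r m
        minor = C , ι , (λ i j → ι-inj) , ι-avoids ,
                ¬rep′ ∘ IsRepresentable-≗ (λ X → sym (MatroidRank.minor-contractionRank isMatroid s-def X))

-- A sentence forbidding a fixed minor

⊤ᶠ : ∀ {e s} → Formula e s
⊤ᶠ = setEq `∅ `∅

⋀-Fin : ∀ {e s} k → (Fin k → Formula e s) → Formula e s
⋀-Fin zero    φ = ⊤ᶠ
⋀-Fin (suc k) φ = φ zero `∧ ⋀-Fin k (φ ∘ suc)

⋀-Subset : ∀ {e s} k → (Subset k → Formula e s) → Formula e s
⋀-Subset zero    φ = φ []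
⋀-Subset (suc k) φ = ⋀-Subset k (φ ∘ (outside ∷_)) `∧ ⋀-Subset k (φ ∘ (inside ∷_))

⋃-singletons : ∀ {e s k} → Subset k → (Fin k → Fin e) → SetTerm e s
⋃-singletons []            x = `∅
⋃-singletons (outside ∷ S) x = ⋃-singletons S (x ∘ suc)
⋃-singletons (inside ∷ S)  x = sing (x zero) `∪ ⋃-singletons S (x ∘ suc)

distinct : ∀ {e s} → Fin e → Fin e → Formula e s
distinct i j with i Fin.≟ j
... | yes _ = ⊤ᶠ
... | no  _ = `¬ elEq i j

∀ᵉ* : ∀ {s} e → Formula e s → Formula 0 s
∀ᵉ* zero    φ = φ
∀ᵉ* (suc e) φ = ∀ᵉ* e (∀e φ)

-- Element variable i stands for the image of element i of L; the one set variable is the contracted set C.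
minorFormula : (L : Structure) → Formula (size L) 1
minorFormula (mkStructure k rL) =
  ⋀-Fin k (λ i → ⋀-Fin k (distinct i)) `∧
  (⋀-Fin k (λ i → `¬ mem i C) `∧
   ⋀-Subset k (λ S → intEq (const (rL S) `+ rank C) (rank (⋃-singletons S id `∪ C))))
  where
  C = svar zero

noMinor : Structure → Sentence
noMinor L = ∀s (∀ᵉ* (size L) (`¬ minorFormula L))

QuantifierFree-⋀-Fin : ∀ {e s} k (φ : Fin k → Formula e s) → (∀ i → QuantifierFree (φ i)) → QuantifierFree (⋀-Fin k φ)
QuantifierFree-⋀-Fin zero    φ φ-qf = tt
QuantifierFree-⋀-Fin (suc k) φ φ-qf = φ-qf zero , QuantifierFree-⋀-Fin k (φ ∘ suc) (φ-qf ∘ suc)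

QuantifierFree-⋀-Subset : ∀ {e s} k (φ : Subset k → Formula e s) →
                          (∀ S → QuantifierFree (φ S)) → QuantifierFree (⋀-Subset k φ)
QuantifierFree-⋀-Subset zero    φ φ-qf = φ-qf []
QuantifierFree-⋀-Subset (suc k) φ φ-qf =
  QuantifierFree-⋀-Subset k _ (φ-qf ∘ (outside ∷_)) , QuantifierFree-⋀-Subset k _ (φ-qf ∘ (inside ∷_))

QuantifierFree-distinct : ∀ {e s} (i j : Fin e) → QuantifierFree {e} {s} (distinct i j)
QuantifierFree-distinct i j with i Fin.≟ j
... | yes _ = tt
... | no  _ = tt

noMinor-MPrenex : ∀ L → MPrenex (noMinor L)
noMinor-MPrenex L@(mkStructure k rL) = ∀q , ∀q , step (elems (∀ᵉ*-block k (qf qf-minorFormula)))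
  where
  ∀ᵉ*-block : ∀ e {φ : Formula e 1} → ElemBlock ∀q φ → ElemBlock ∀q (∀ᵉ* e φ)
  ∀ᵉ*-block zero    block = block
  ∀ᵉ*-block (suc e) block = ∀ᵉ*-block e (step block)
  qf-minorFormula : QuantifierFree (minorFormula L)
  qf-minorFormula = QuantifierFree-⋀-Fin k _ (λ i → QuantifierFree-⋀-Fin k _ (QuantifierFree-distinct i)) ,
                    QuantifierFree-⋀-Fin k _ (λ _ → tt) ,
                    QuantifierFree-⋀-Subset k _ (λ _ → tt)

module MinorFormulaSemantics (n : ℕ) (r : Subset n → ℕ) where

  open Semantics n r

  ⟦⋀-Fin⟧ : ∀ {e s} k (φ : Fin k → Formula e s) {ρ σ} → ⟦ ⋀-Fin k φ ⟧ ρ σ ⇔ (∀ i → ⟦ φ i ⟧ ρ σ)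
  ⟦⋀-Fin⟧ zero    φ = mk⇔ (λ _ ()) (λ _ → refl)
  ⟦⋀-Fin⟧ (suc k) φ = mk⇔
    (λ (φ0 , φs) → λ { zero → φ0 ; (suc i) → Equivalence.to (⟦⋀-Fin⟧ k (φ ∘ suc)) φs i })
    (λ all → all zero , Equivalence.from (⟦⋀-Fin⟧ k (φ ∘ suc)) (all ∘ suc))

  ⟦⋀-Subset⟧ : ∀ {e s} k (φ : Subset k → Formula e s) {ρ σ} → ⟦ ⋀-Subset k φ ⟧ ρ σ ⇔ (∀ S → ⟦ φ S ⟧ ρ σ)
  ⟦⋀-Subset⟧ zero    φ = mk⇔ (λ { φ[] [] → φ[] }) (λ all → all [])
  ⟦⋀-Subset⟧ (suc k) φ = mk⇔
    (λ { (φo , φi) (outside ∷ S) → Equivalence.to (⟦⋀-Subset⟧ k _) φo S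
       ; (φo , φi) (inside ∷ S)  → Equivalence.to (⟦⋀-Subset⟧ k _) φi S })
    (λ all → Equivalence.from (⟦⋀-Subset⟧ k _) (all ∘ (outside ∷_)) ,
             Equivalence.from (⟦⋀-Subset⟧ k _) (all ∘ (inside ∷_)))

  ⟦⋃-singletons⟧ : ∀ {e s k} (S : Subset k) (x : Fin k → Fin e) {ρ σ} →
                   ⟦ ⋃-singletons {s = s} S x ⟧ˢ ρ σ ≡ image (lookup ρ ∘ x) S
  ⟦⋃-singletons⟧ []            x {ρ} = sym (image-∅ (lookup ρ ∘ x))
  ⟦⋃-singletons⟧ (outside ∷ S) x {ρ} = trans (⟦⋃-singletons⟧ S (x ∘ suc)) (sym (image-outside∷ (lookup ρ ∘ x) S))
  ⟦⋃-singletons⟧ (inside ∷ S)  x {ρ} =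
    trans (cong (⁅ lookup ρ (x zero) ⁆ ∪_) (⟦⋃-singletons⟧ S (x ∘ suc))) (sym (image-inside∷ (lookup ρ ∘ x) S))

  ⟦distinct⟧ : ∀ {e s} (i j : Fin e) {ρ σ} → ⟦ distinct {s = s} i j ⟧ ρ σ ⇔ (i ≢ j → lookup ρ i ≢ lookup ρ j)
  ⟦distinct⟧ i j with i Fin.≟ j
  ... | yes i≡j = mk⇔ (λ _ i≢j → contradiction i≡j i≢j) (λ _ → refl)
  ... | no  i≢j = mk⇔ (λ ρi≢ρj _ → ρi≢ρj) (λ ρ-distinct → ρ-distinct i≢j)

  ⟦∀ᵉ*⟧ : ∀ {s} e (φ : Formula e s) {σ} → ⟦ ∀ᵉ* e φ ⟧ [] σ ⇔ (∀ ρ → ⟦ φ ⟧ ρ σ)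
  ⟦∀ᵉ*⟧ zero    φ = mk⇔ (λ { φ[] [] → φ[] }) (λ all → all [])
  ⟦∀ᵉ*⟧ (suc e) φ = mk⇔
    (λ all → λ { (x ∷ ρ) → Equivalence.to (⟦∀ᵉ*⟧ e (∀e φ)) all ρ x })
    (λ all → Equivalence.from (⟦∀ᵉ*⟧ e (∀e φ)) (λ ρ x → all (x ∷ ρ)))

  minorFormula⇔IsMinorOf : ∀ L → (∃[ C ] ∃[ ρ ] ⟦ minorFormula L ⟧ ρ (C ∷ [])) ⇔ IsMinorOf L (mkStructure n r)
  minorFormula⇔IsMinorOf (mkStructure k rL) = mk⇔ to from
    where
    to : (∃[ C ] ∃[ ρ ] ⟦ minorFormula (mkStructure k rL) ⟧ ρ (C ∷ [])) → IsMinorOf (mkStructure k rL) (mkStructure n r)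
    to (C , ρ , distinct-ρ , avoid-C , rank-ρ) = C , lookup ρ , ρ-inj , Equivalence.to (⟦⋀-Fin⟧ k _) avoid-C , rank-eq
      where
      ρ-inj : Injective _≡_ _≡_ (lookup ρ)
      ρ-inj {i} {j} ρi≡ρj with i Fin.≟ j
      ... | yes i≡j = i≡j
      ... | no  i≢j = contradiction ρi≡ρj
        (Equivalence.to (⟦distinct⟧ i j) (Equivalence.to (⟦⋀-Fin⟧ k _) (Equivalence.to (⟦⋀-Fin⟧ k _) distinct-ρ i) j) i≢j)
      rank-eq : ∀ S → rL S + r C ≡ r (image (lookup ρ) S ∪ C)
      rank-eq S = trans (Equivalence.to (⟦⋀-Subset⟧ k _) rank-ρ S) (cong (λ Z → r (Z ∪ C)) (⟦⋃-singletons⟧ S id))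
    from : IsMinorOf (mkStructure k rL) (mkStructure n r) → ∃[ C ] ∃[ ρ ] ⟦ minorFormula (mkStructure k rL) ⟧ ρ (C ∷ [])
    from (C , ι , ι-inj , ι-avoids , rank-ι) =
      C , ρ ,
      Equivalence.from (⟦⋀-Fin⟧ k _) (λ i → Equivalence.from (⟦⋀-Fin⟧ k _) (λ j →
        Equivalence.from (⟦distinct⟧ i j) (λ i≢j ρi≡ρj → i≢j (ι-inj (trans (sym (ρ≗ι i)) (trans ρi≡ρj (ρ≗ι j))))))) ,
      Equivalence.from (⟦⋀-Fin⟧ k _) (λ i → ι-avoids i ∘ subst (_∈ C) (ρ≗ι i)) ,
      Equivalence.from (⟦⋀-Subset⟧ k _) (λ S →
        trans (rank-ι S) (cong (λ Z → r (Z ∪ C)) (sym (trans (⟦⋃-singletons⟧ S id) (image-cong ρ≗ι S)))))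
      where
      ρ = tabulate ι
      ρ≗ι : ∀ i → lookup ρ i ≡ ι i
      ρ≗ι = lookup∘tabulate ι

Sat-noMinor : ∀ M L → Sat M (noMinor L) ⇔ (¬ IsMinorOf L M)
Sat-noMinor (mkStructure n r) L = mk⇔
  (λ sat L≤M → let (C , ρ , φ) = Equivalence.from (minorFormula⇔IsMinorOf L) L≤M in
               Equivalence.to (⟦∀ᵉ*⟧ (size L) _) (sat C) ρ φ)
  (λ L≰M C → Equivalence.from (⟦∀ᵉ*⟧ (size L) _)
                (λ ρ φ → L≰M (Equivalence.to (minorFormula⇔IsMinorOf L) (C , ρ , φ))))
  where
  open Semantics n r
  open MinorFormulaSemantics n r

Sat-R123⇔IsMatroid : ∀ M → (Sat M R1 × Sat M R2 × Sat M R3) ⇔ IsMatroid M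
Sat-R123⇔IsMatroid (mkStructure n r) = mk⇔
  (λ (R1-sat , R2-sat , R3-sat) →
     R1-sat , (λ X Y X⊆Y → [ (λ X⊈Y → contradiction (λ {x} → X⊆Y {x}) X⊈Y) , id ] (R2-sat X Y)) , R3-sat)
  (λ (r≤∣∣ , r-mono , r-submodular) → r≤∣∣ , R2-sat r-mono , r-submodular)
  where
  R2-sat : (∀ X Y → X ⊆ Y → r X ≤ r Y) → ∀ X Y → ¬ X ⊆ Y ⊎ r X ≤ r Y
  R2-sat r-mono X Y with X ⊆? Y
  ... | yes X⊆Y = inj₂ (r-mono X Y X⊆Y)
  ... | no  X⊈Y = inj₁ X⊈Y

module Forbidden (F : Field) (finite : IsFiniteField F) where

  open FiniteField F finite

  -- Representable entries of the list must be dropped: forbidding them as minors would exclude representable matroids.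
  forbidden : List Structure → List Sentence
  forbidden Ls = map noMinor (filter (¬? ∘ IsRepresentable?) Ls)

  forbidden-InMLogic : ∀ Ls → All InMLogic (forbidden Ls)
  forbidden-InMLogic Ls = All-map⁺ (universal (λ L → noMinor L , noMinor-MPrenex L , λ _ → mk⇔ id id) _)

  representable⇒Sat-forbidden : ∀ {M} → IsRepresentable F M → ∀ Ls → All (Sat M) (forbidden Ls)
  representable⇒Sat-forbidden {M} rep Ls = All-map⁺ (All-map
    (λ {L} ¬rep → Equivalence.from (Sat-noMinor M L) (¬rep ∘ minor-isRepresentable rep))
    (all-filter (¬? ∘ IsRepresentable?) Ls))

  Sat-forbidden⇒no-minor : ∀ {M} Ls → All (Sat M) (forbidden Ls) →
                           ¬ Any (λ L → ¬ IsRepresentable F L × IsMinorOf L M) Ls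
  Sat-forbidden⇒no-minor {M} Ls sat hit = proj₁ (lookupAny no-bad-minor hit) (proj₂ (lookupAny no-bad-minor hit))
    where
    no-bad-minor : All (λ L → ¬ IsRepresentable F L × IsMinorOf L M → ⊥) Ls
    no-bad-minor = All-filter⁻ (¬? ∘ IsRepresentable?)
      (All-map (λ {L} sat-L (_ , L≤M) → Equivalence.to (Sat-noMinor M L) sat-L L≤M) (All-map⁻ sat))
      (All-map (λ ¬¬rep (¬rep , _) → ¬¬rep ¬rep) (all-filter (¬? ∘ ¬? ∘ IsRepresentable?) Ls))

  isomorphic-to-excluded : ∀ {N L} → IsExcludedMinor F N → Isomorphic N L → ¬ IsRepresentable F L × IsMinorOf L N
  isomorphic-to-excluded (N-mat , ¬N-rep , _) N≅L =
    let (N≤L , L≤N) = isomorphic⇒minors N-mat N≅L in (λ L-rep → ¬N-rep (minor-isRepresentable L-rep N≤L)) , L≤N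

lemma3p1 : RotasConjecture →
    ∀ (F : Field) → IsFiniteField F →
      Σ (List Sentence) λ Q →
        All InMLogic Q ×
        (∀ (M : Structure) → IsRepresentable F M ⇔ SatAll M (R1 ∷ R2 ∷ R3 ∷ Q))
lemma3p1 rota F finite with rota F finite
... | excluded , excluded-complete = forbidden excluded , forbidden-InMLogic excluded , λ M → mk⇔ (sound M) (complete M)
  where
  open FiniteField F finite
  open Forbidden F finite
  sound : ∀ M → IsRepresentable F M → SatAll M (R1 ∷ R2 ∷ R3 ∷ forbidden excluded)
  sound M rep = let (R1-sat , R2-sat , R3-sat) = Equivalence.from (Sat-R123⇔IsMatroid M) (proj₁ rep) in
    R1-sat ∷ R2-sat ∷ R3-sat ∷ representable⇒Sat-forbidden rep excluded
  complete : ∀ M → SatAll M (R1 ∷ R2 ∷ R3 ∷ forbidden excluded) → IsRepresentable F M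
  complete M (R1-sat ∷ R2-sat ∷ R3-sat ∷ sat)
    with excludedMinor-or-representable M (Equivalence.to (Sat-R123⇔IsMatroid M) (R1-sat , R2-sat , R3-sat))
  ... | inj₁ rep = rep
  ... | inj₂ (N , N-excluded , N≤M) = contradiction
    (Any-map (λ {L} N≅L → let (¬rep , L≤N) = isomorphic-to-excluded N-excluded N≅L in ¬rep , minor-trans {L} {N} L≤N N≤M)
             (excluded-complete N N-excluded))
    (Sat-forbidden⇒no-minor excluded sat)
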